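{- Let $k\ge1$, $m=2^{k-1}$, $r\ge0$, $n=2^r$, let $I=(i_1,\dots,i_k)$ be nonnegative integers with $i_1+2i_2+\dots+k\,i_k=r$, and let $\mathcal H_I\subseteq Z_{2^k}^n$ be the linear code defined below. Then the co-$Z_{2^k}$-linear code $\tilde H_I=\Phi(\mathcal H_I)$ is a binary $(nm,\,2^{nm}/2nm,\,4)$-code, i.e. an extended $1$-perfect code.
   Context: Let $\bar b_1,\dots,\bar b_n$ be all elements of $\{1\}\times(2^{k-1}Z_{2^k})^{i_1}\times(2^{k-2}Z_{2^k})^{i_2}\times\dots\times(2^0Z_{2^k})^{i_k}$ in lexicographic order, $B_I$ the matrix with these columns, and $\mathcal H_I=\{\bar h\in Z_{2^k}^n:B_I\bar h^T=\bar0\}$. Let $\{H_0,\dots,H_{2m-1}\}$ be a partition of $Z_2^m$ into extended $1$-perfect binary $(m,2^m/2m,4)$-codes with $\bar0\in H_0$ and all words of $H_j$ having Hamming weight of the parity of $j$; $\Phi(x_1,\dots,x_n)=H_{x_1}\times\dots\times H_{x_n}$ and $\Phi(\mathcal C)=\bigcup_{\bar x\in\mathcal C}\Phi(\bar x)$. A binary $(N,M,d)$-code is a subset of $Z_2^N$ of size $M$ with pairwise Hamming distances at least $d$. -}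

module Defs where

open import Data.Nat using (ℕ; zero; suc; _+_; _*_; _∸_; _^_; _≤_; _<_)
open import Data.Nat.DivMod using (_/_)
open import Data.Nat.Divisibility using (_∣_)
open import Data.Nat.ListAction using (sum)
open import Data.Bool using (Bool; true; false)
open import Data.Fin using (Fin; toℕ)
open import Data.List as L using (List; []; _∷_; [_]; length; upTo; zipWith; concatMap; replicate)
open import Data.List.Membership.Propositional using (_∈_)
open import Data.List.Relation.Unary.Unique.Propositional using (Unique)
open import Data.Vec as V using (Vec; lookup; concat; toList)
open import Data.Product using (Σ; _×_; ∃-syntax)
open import Function.Bundles using (_⇔_)
open import Relation.Binary.PropositionalEquality using (_≡_; _≢_)

weight : ∀ {N} → Vec Bool N → ℕ
weight V.[] = 0
weight (true V.∷ xs) = suc (weight xs)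
weight (false V.∷ xs) = weight xs

dist : ∀ {N} → Vec Bool N → Vec Bool N → ℕ
dist V.[] V.[] = 0
dist (true V.∷ xs) (true V.∷ ys) = dist xs ys
dist (false V.∷ xs) (false V.∷ ys) = dist xs ys
dist (true V.∷ xs) (false V.∷ ys) = suc (dist xs ys)
dist (false V.∷ xs) (true V.∷ ys) = suc (dist xs ys)

HasSize : {A : Set} → (A → Set) → ℕ → Set
HasSize {A} P M = Σ (List A) λ xs → Unique xs × (∀ x → (x ∈ xs) ⇔ P x) × length xs ≡ M

IsBinaryCode : (N M d : ℕ) → (Vec Bool N → Set) → Set
IsBinaryCode N M d C =
  HasSize C M × (∀ x y → C x → C y → x ≢ y → d ≤ dist x y)

-- Natural-number division, total (division by 0 yields 0; never used
-- with divisor 0 below).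
_div_ : ℕ → ℕ → ℕ
a div zero = 0
a div suc d = a / suc d

-- the parameter M = 2^N / 2N of an extended 1-perfect code of length N
perfectSize : ℕ → ℕ
perfectSize N = (2 ^ N) div (2 * N)

mOf : ℕ → ℕ
mOf k = 2 ^ (k ∸ 1)

-- elements of 2^{k-j} Z_{2^k} (as residues in [0, 2^k)), in increasing order
subgroupElems : (k j : ℕ) → List ℕ
subgroupElems k j = L.map (λ a → 2 ^ (k ∸ j) * a) (upTo (2 ^ j))

-- the coordinate sets {1}, (2^{k-1}Z)^{i_1}, ..., (2^0 Z)^{i_k}
choiceSets : (k : ℕ) → Vec ℕ k → List (List ℕ)
choiceSets k I =
  [ 1 ] ∷ L.concat (toList (V.map (λ j → replicate (lookup I j) (subgroupElems k (suc (toℕ j))))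
                                  (V.allFin k)))

tuples : List (List ℕ) → List (List ℕ)
tuples [] = [ [] ]
tuples (S ∷ Ss) = concatMap (λ x → L.map (x ∷_) (tuples Ss)) S

columns : (k : ℕ) → Vec ℕ k → List (List ℕ)
columns k I = tuples (choiceSets k I)

weightedSum : ∀ {k} → Vec ℕ k → ℕ
weightedSum {k} I = sum (toList (V.zipWith _*_ (V.map (λ j → suc (toℕ j)) (V.allFin k)) I))

-- t-th entry of a column (0 outside)
entry : List ℕ → ℕ → ℕ
entry [] t = 0
entry (x ∷ xs) zero = x
entry (x ∷ xs) (suc t) = entry xs t

-- H_I = { h ∈ Z_{2^k}^n : B_I h^T = 0 }, Z_{2^k} represented by Fin (2^k)
HI : (k : ℕ) (I : Vec ℕ k) → Vec (Fin (2 ^ k)) (length (columns k I)) → Set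
HI k I h = ∀ t → t < length (choiceSets k I) →
  (2 ^ k) ∣ sum (zipWith (λ b x → entry b t * x) (columns k I) (toList (V.map toℕ h)))

IsGoodPartition : (m : ℕ) → (ℕ → Vec Bool m → Set) → Set
IsGoodPartition m H =
  (∀ j → j < 2 * m → IsBinaryCode m (perfectSize m) 4 (H j))
  × (∀ w → ∃[ j ] (j < 2 * m × H j w))
  × (∀ j j' w → j < 2 * m → j' < 2 * m → H j w → H j' w → j ≡ j')
  × H 0 (V.replicate m false)
  × (∀ j w → j < 2 * m → H j w → weight w % 2 ≡ j % 2)
  where open import Data.Nat using (_%_)

Φ : ∀ {q n m} → (ℕ → Vec Bool m → Set) → (Vec (Fin q) n → Set) → Vec Bool (n * m) → Set
Φ {n = n} {m} H C y =
  ∃[ x ] (C x × ∃[ ys ] (y ≡ concat ys × (∀ i → H (toℕ (lookup x i)) (lookup ys i))))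

module Submission where

-- With q = 2^k, the syndrome map h ↦ B_I h is a homomorphism from Z_q^n onto
-- Z_q × S₁ × ⋯ × Sₗ, where {1} × S₁ × ⋯ × Sₗ is the set of columns; this image has q·n elements
-- and the fibres are translates of H_I, so |H_I| = q^n / qn. Φ replaces each coordinate by one of
-- the 2^m / q words of some H_j, and (2^m / q)^n · q^n / qn = 2^{nm} / 2nm.
--
-- The first row of B_I is all ones and the words of H_j have the parity of j, so every
-- word of Φ(H_I) has even weight and all distances are even. Words over the same x ∈ H_I differ
-- inside a single H_j, hence by ≥ 4. For x ≠ x′ in H_I, a difference in exactly one coordinate
-- contradicts the all-ones row, and a difference in three or more gives distance ≥ 3. If x and x′
-- differ exactly at i and j, the rows give (b_i − b_j)(x_i − x′_i) ≡ 0 (mod 2^k); as b_i ≠ b_j,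
-- x_i − x′_i is even, so the blocks at i are at distance ≥ 2 and those at j at distance ≥ 1.
-- Evenness turns each bound ≥ 3 into ≥ 4.

open import Data.Bool using (Bool; true; false)
open import Data.Bool.Properties using () renaming (_≟_ to _≟ᵇ_)
open import Data.Fin as F using (Fin; zero; suc; toℕ; fromℕ<)
open import Data.Fin.Properties using (toℕ<n; toℕ-injective; toℕ-fromℕ<; ¬∀⟶∃¬)
open import Data.List as L
  using (List; []; _∷_; [_]; length; map; upTo; zipWith; tabulate; filter; concatMap; cartesianProductWith; replicate)
import Data.List.Properties as Listₚ
open import Data.List.Properties using (length-++; length-map; length-upTo; length-tabulate; map-++; tabulate-cong)
open import Data.List.Membership.Propositional using (_∈_; _∉_; find; lose)
open import Data.List.Membership.Propositional.Properties
  using (∈-∃++; ∈-map⁺; ∈-map⁻; ∈-concatMap⁺; ∈-concatMap⁻; ∈-cartesianProductWith⁺; ∈-cartesianProductWith⁻;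
         ∈-filter⁺; ∈-filter⁻; ∈-allFin; ∈-upTo⁺; ∈-upTo⁻; ∈-lookup)
open import Data.List.Relation.Binary.Subset.Propositional using (_⊆_)
open import Data.List.Relation.Binary.Pointwise using (Pointwise; []; _∷_; Pointwise-length)
open import Data.List.Relation.Unary.All as All using (All; []; _∷_)
import Data.List.Relation.Unary.All.Properties as Allₚ
open import Data.List.Relation.Unary.AllPairs using ([]; _∷_)
open import Data.List.Relation.Unary.Any using (here; there; index)
open import Data.List.Relation.Unary.Any.Properties using (lookup-index)
open import Data.List.Relation.Unary.Unique.Propositional using (Unique)
import Data.List.Relation.Unary.Unique.Propositional.Properties as Unique
open import Data.Nat using (ℕ; zero; suc; _+_; _*_; _∸_; _^_; _≤_; _<_; z≤n; s≤s; NonZero; >-nonZero⁻¹; _%_; _/_)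
open import Data.Nat.Properties
open import Data.Nat.DivMod
  using (m≡m%n+[m/n]*n; [m+kn]%n≡m%n; m<n⇒m%n≡m; m*n%n≡0; m%n%n≡m%n; m%n<n; m*n/n≡m; m/n*n≡m)
open import Data.Nat.Divisibility
  using (_∣_; divides; ∣-trans; *-cancelˡ-∣; *-monoʳ-∣; 1∣_; m∣m*n; m%n≡0⇒n∣m; n∣m⇒m%n≡0)
open import Data.Nat.ListAction using (sum; product)
open import Data.Nat.ListAction.Properties using (product-++)
open import Data.Nat.Primality using (Prime; euclidsLemma; prime⇒nonZero; prime[2])
open import Data.Nat.Solver using (module +-*-Solver)
open import Data.Product using (∃; ∃₂; _×_; _,_; proj₁; proj₂)
open import Data.Sum using (inj₁; inj₂)
open import Data.Vec as V using (Vec; []; _∷_; _++_; lookup; toList; allFin; concat; _[_]≔_)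
import Data.Vec.Properties as Vecₚ
open import Function using (_∘_)
open import Function.Bundles using (_⇔_; mk⇔; Equivalence)
open import Relation.Binary.Bundles using (Setoid)
open import Relation.Binary.Definitions using (DecidableEquality)
open import Relation.Binary.PropositionalEquality hiding ([_])
import Relation.Binary.Reasoning.Setoid as SetoidReasoning
open import Relation.Nullary using (¬_; ¬?; Dec; yes; no; contradiction)

open import Defs

open +-*-Solver

xy+z≡xz+y : ∀ x y z → x + y + z ≡ x + z + y
xy+z≡xz+y x y z = trans (+-assoc x y z) (trans (cong (x +_) (+-comm y z)) (sym (+-assoc x z y)))

-- Congruence witnessed by a + u q = b + v q, which avoids truncated subtraction.
infix 4 _≡_mod_

_≡_mod_ : ℕ → ℕ → ℕ → Set
_≡_mod_ a b q = ∃₂ λ u v → a + u * q ≡ b + v * q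

module _ {q : ℕ} where

  mod-refl : ∀ {a} → a ≡ a mod q
  mod-refl = 0 , 0 , refl

  mod-sym : ∀ {a b} → a ≡ b mod q → b ≡ a mod q
  mod-sym (u , v , e) = v , u , sym e

  mod-trans : ∀ {a b c} → a ≡ b mod q → b ≡ c mod q → a ≡ c mod q
  mod-trans {a} {b} {c} (u , v , e) (u′ , v′ , e′) = u + u′ , v′ + v , (begin
    a + (u + u′) * q   ≡⟨ solve 4 (λ a u u′ q → a :+ (u :+ u′) :* q := (a :+ u :* q) :+ u′ :* q) refl a u u′ q ⟩
    a + u * q + u′ * q ≡⟨ cong (_+ u′ * q) e ⟩
    b + v * q + u′ * q ≡⟨ solve 4 (λ b v u′ q → b :+ v :* q :+ u′ :* q := (b :+ u′ :* q) :+ v :* q) refl b v u′ q ⟩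
    b + u′ * q + v * q ≡⟨ cong (_+ v * q) e′ ⟩
    c + v′ * q + v * q ≡⟨ solve 4 (λ c v′ v q → c :+ v′ :* q :+ v :* q := c :+ (v′ :+ v) :* q) refl c v′ v q ⟩
    c + (v′ + v) * q   ∎)
    where open ≡-Reasoning

  ≡⇒mod : ∀ {a b} → a ≡ b → a ≡ b mod q
  ≡⇒mod refl = mod-refl

  mod-+ : ∀ {a b c d} → a ≡ b mod q → c ≡ d mod q → a + c ≡ b + d mod q
  mod-+ {a} {b} {c} {d} (u , v , e) (u′ , v′ , e′) = u + u′ , v + v′ , (begin
    a + c + (u + u′) * q
      ≡⟨ solve 5 (λ a c u u′ q → a :+ c :+ (u :+ u′) :* q := (a :+ u :* q) :+ (c :+ u′ :* q)) refl a c u u′ q ⟩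
    (a + u * q) + (c + u′ * q)   ≡⟨ cong₂ _+_ e e′ ⟩
    (b + v * q) + (d + v′ * q)
      ≡⟨ solve 5 (λ b d v v′ q → (b :+ v :* q) :+ (d :+ v′ :* q) := b :+ d :+ (v :+ v′) :* q) refl b d v v′ q ⟩
    b + d + (v + v′) * q         ∎)
    where open ≡-Reasoning

  mod-*ˡ : ∀ c {a b} → a ≡ b mod q → c * a ≡ c * b mod q
  mod-*ˡ c {a} {b} (u , v , e) = c * u , c * v , (begin
    c * a + c * u * q   ≡⟨ solve 4 (λ c a u q → c :* a :+ c :* u :* q := c :* (a :+ u :* q)) refl c a u q ⟩
    c * (a + u * q)     ≡⟨ cong (c *_) e ⟩
    c * (b + v * q)     ≡⟨ solve 4 (λ c b v q → c :* (b :+ v :* q) := c :* b :+ c :* v :* q) refl c b v q ⟩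
    c * b + c * v * q   ∎)
    where open ≡-Reasoning

  mod-cancel-+ˡ : ∀ a {b c} → a + b ≡ a + c mod q → b ≡ c mod q
  mod-cancel-+ˡ a {b} {c} (u , v , e) = u , v , +-cancelˡ-≡ a _ _
    (trans (sym (+-assoc a b (u * q))) (trans e (+-assoc a c (v * q))))

  mod-self : q ≡ 0 mod q
  mod-self = 0 , 1 , refl

  *-mod-self : ∀ a → a * q ≡ 0 mod q
  *-mod-self a = 0 , a , +-identityʳ (a * q)

  mod-∣ : ∀ {d a b} → d ∣ q → a ≡ b mod q → a ≡ b mod d
  mod-∣ {d} {a} {b} (divides c refl) (u , v , e) = u * c , v * c ,
    trans (cong (a +_) (*-assoc u c d)) (trans e (cong (b +_) (sym (*-assoc v c d))))

mod-setoid : ℕ → Setoid _ _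
mod-setoid q = record { Carrier = ℕ ; _≈_ = λ a b → a ≡ b mod q
  ; isEquivalence = record { refl = mod-refl ; sym = mod-sym ; trans = mod-trans } }

module ≡-mod-Reasoning (q : ℕ) = SetoidReasoning (mod-setoid q)

module _ (q : ℕ) .{{_ : NonZero q}} where

  mod⇒%≡ : ∀ {a b} → a ≡ b mod q → a % q ≡ b % q
  mod⇒%≡ {a} {b} (u , v , e) =
    trans (sym ([m+kn]%n≡m%n a u q)) (trans (cong (_% q) e) ([m+kn]%n≡m%n b v q))

  %≡⇒mod : ∀ {a b} → a % q ≡ b % q → a ≡ b mod q
  %≡⇒mod {a} {b} e = b / q , a / q , (begin
    a + b / q * q                 ≡⟨ cong (_+ b / q * q) (m≡m%n+[m/n]*n a q) ⟩
    a % q + a / q * q + b / q * q ≡⟨ cong (λ z → z + a / q * q + b / q * q) e ⟩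
    b % q + a / q * q + b / q * q ≡⟨ xy+z≡xz+y (b % q) (a / q * q) (b / q * q) ⟩
    b % q + b / q * q + a / q * q ≡⟨ cong (_+ a / q * q) (sym (m≡m%n+[m/n]*n b q)) ⟩
    b + a / q * q                 ∎)
    where open ≡-Reasoning

  %-mod : ∀ a → a % q ≡ a mod q
  %-mod a = %≡⇒mod (m%n%n≡m%n a q)

  mod-<⇒≡ : ∀ {a b} → a ≡ b mod q → a < q → b < q → a ≡ b
  mod-<⇒≡ {a} {b} a≡b a<q b<q = trans (sym (m<n⇒m%n≡m a<q)) (trans (mod⇒%≡ a≡b) (m<n⇒m%n≡m b<q))

  ∣⇒mod0 : ∀ {a} → q ∣ a → a ≡ 0 mod q
  ∣⇒mod0 {a} q∣a = %≡⇒mod (trans (n∣m⇒m%n≡0 a q q∣a) (sym (m*n%n≡0 0 q)))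

  mod0⇒∣ : ∀ {a} → a ≡ 0 mod q → q ∣ a
  mod0⇒∣ {a} a≡0 = m%n≡0⇒n∣m a q (trans (mod⇒%≡ a≡0) (m*n%n≡0 0 q))

  mod-<⇒%≡ : ∀ {a b} → a ≡ b mod q → b < q → a % q ≡ b
  mod-<⇒%≡ {a} {b} a≡b b<q = trans (mod⇒%≡ a≡b) (m<n⇒m%n≡m b<q)

private
  ∈-remove : ∀ {A : Set} {x y : A} xs {ys} → y ∈ xs L.++ x ∷ ys → y ≢ x → y ∈ xs L.++ ys
  ∈-remove []       (here y≡x)  y≢x = contradiction y≡x y≢x
  ∈-remove []       (there y∈)  _   = y∈
  ∈-remove (_ ∷ xs) (here y≡z)  _   = here y≡z
  ∈-remove (_ ∷ xs) (there y∈)  y≢x = there (∈-remove xs y∈ y≢x)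

  length-insert : ∀ {A : Set} (xs : List A) {x ys} → length (xs L.++ x ∷ ys) ≡ suc (length (xs L.++ ys))
  length-insert []       = refl
  length-insert (_ ∷ xs) = cong suc (length-insert xs)

Unique⇒length≤ : ∀ {A : Set} {xs ys : List A} → Unique xs → xs ⊆ ys → length xs ≤ length ys
Unique⇒length≤ {xs = []} _ _ = z≤n
Unique⇒length≤ {xs = x ∷ xs} (x∉xs ∷ xs!) xs⊆ys with ∈-∃++ (xs⊆ys (here refl))
... | us , vs , refl = subst (_ ≤_) (sym (length-insert us))
  (s≤s (Unique⇒length≤ xs! λ y∈xs → ∈-remove us (xs⊆ys (there y∈xs)) λ { refl → All.lookup x∉xs y∈xs refl }))

Unique⇒length≡ : ∀ {A : Set} {xs ys : List A} → Unique xs → Unique ys → xs ⊆ ys → ys ⊆ xs → length xs ≡ length ys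
Unique⇒length≡ xs! ys! xs⊆ys ys⊆xs = ≤-antisym (Unique⇒length≤ xs! xs⊆ys) (Unique⇒length≤ ys! ys⊆xs)

module _ {A B : Set} (f : A → List B) where

  Unique-concatMap : ∀ {xs} → Unique xs → (∀ x → Unique (f x)) →
    (∀ {x x′ y} → y ∈ f x → y ∈ f x′ → x ≡ x′) → Unique (concatMap f xs)
  Unique-concatMap {[]} _ _ _ = []
  Unique-concatMap {x ∷ xs} (x∉xs ∷ xs!) f! disjoint =
    Unique.++⁺ (f! x) (Unique-concatMap xs! f! disjoint) λ (y∈fx , y∈rest) →
      let x′ , x′∈xs , y∈fx′ = find (∈-concatMap⁻ f y∈rest) in All.lookup x∉xs x′∈xs (disjoint y∈fx y∈fx′)

  length-concatMap-const : ∀ xs {K} → (∀ {x} → x ∈ xs → length (f x) ≡ K) → length (concatMap f xs) ≡ length xs * K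
  length-concatMap-const [] _ = refl
  length-concatMap-const (x ∷ xs) f≡K =
    trans (length-++ (f x)) (cong₂ _+_ (f≡K (here refl)) (length-concatMap-const xs (f≡K ∘ there)))

length-cartesianProductWith : ∀ {A B C : Set} (f : A → B → C) xs ys →
  length (cartesianProductWith f xs ys) ≡ length xs * length ys
length-cartesianProductWith f [] ys = refl
length-cartesianProductWith f (x ∷ xs) ys =
  trans (length-++ (map (f x) ys)) (cong₂ _+_ (length-map (f x) ys) (length-cartesianProductWith f xs ys))

concatMap-map≡cartesianProductWith : ∀ {A B C : Set} (f : A → B → C) xs ys →
  concatMap (λ x → map (f x) ys) xs ≡ cartesianProductWith f xs ys
concatMap-map≡cartesianProductWith f [] ys = refl
concatMap-map≡cartesianProductWith f (x ∷ xs) ys =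
  cong (map (f x) ys L.++_) (concatMap-map≡cartesianProductWith f xs ys)

tuples-∷ : ∀ S Ss → tuples (S ∷ Ss) ≡ cartesianProductWith _∷_ S (tuples Ss)
tuples-∷ S Ss = concatMap-map≡cartesianProductWith _∷_ S (tuples Ss)

∈-tuples⁺ : ∀ {xs Ss} → Pointwise _∈_ xs Ss → xs ∈ tuples Ss
∈-tuples⁺ [] = here refl
∈-tuples⁺ {x ∷ xs} {S ∷ Ss} (x∈S ∷ xs∈Ss) =
  subst (x ∷ xs ∈_) (sym (tuples-∷ S Ss)) (∈-cartesianProductWith⁺ _∷_ x∈S (∈-tuples⁺ xs∈Ss))

∈-tuples⁻ : ∀ {xs} Ss → xs ∈ tuples Ss → Pointwise _∈_ xs Ss
∈-tuples⁻ [] (here refl) = []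
∈-tuples⁻ (S ∷ Ss) xs∈ with ∈-cartesianProductWith⁻ _∷_ S (tuples Ss) (subst (_ ∈_) (tuples-∷ S Ss) xs∈)
... | x , xs , x∈S , xs∈ , refl = x∈S ∷ ∈-tuples⁻ Ss xs∈

Unique-tuples : ∀ {Ss} → All Unique Ss → Unique (tuples Ss)
Unique-tuples [] = [] ∷ []
Unique-tuples {S ∷ Ss} (S! ∷ Ss!) = subst Unique (sym (tuples-∷ S Ss))
  (Unique.cartesianProductWith⁺ _∷_ Listₚ.∷-injective S! (Unique-tuples Ss!))

length-tuples : ∀ Ss → length (tuples Ss) ≡ product (map length Ss)
length-tuples [] = refl
length-tuples (S ∷ Ss) = trans (cong length (tuples-∷ S Ss))
  (trans (length-cartesianProductWith _∷_ S (tuples Ss)) (cong (length S *_) (length-tuples Ss)))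

choices : ∀ {A : Set} {n} → Vec (List A) n → List (Vec A n)
choices [] = [ [] ]
choices (xs ∷ xss) = cartesianProductWith _∷_ xs (choices xss)

module _ {A : Set} where

  ∈-choices⁺ : ∀ {n} (xss : Vec (List A) n) ys → (∀ i → lookup ys i ∈ lookup xss i) → ys ∈ choices xss
  ∈-choices⁺ [] [] _ = here refl
  ∈-choices⁺ (xs ∷ xss) (y ∷ ys) ys∈ = ∈-cartesianProductWith⁺ _∷_ (ys∈ zero) (∈-choices⁺ xss ys λ i → ys∈ (suc i))

  ∈-choices⁻ : ∀ {n} (xss : Vec (List A) n) {ys} → ys ∈ choices xss → ∀ i → lookup ys i ∈ lookup xss i
  ∈-choices⁻ (xs ∷ xss) ys∈ i with ∈-cartesianProductWith⁻ _∷_ xs (choices xss) ys∈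
  ∈-choices⁻ (xs ∷ xss) ys∈ zero    | y , ys , y∈xs , _ , refl = y∈xs
  ∈-choices⁻ (xs ∷ xss) ys∈ (suc i) | y , ys , _ , ys∈′ , refl = ∈-choices⁻ xss ys∈′ i

  Unique-choices : ∀ {n} (xss : Vec (List A) n) → (∀ i → Unique (lookup xss i)) → Unique (choices xss)
  Unique-choices [] _ = [] ∷ []
  Unique-choices (xs ∷ xss) xss! = Unique.cartesianProductWith⁺ _∷_ Vecₚ.∷-injective
    (xss! zero) (Unique-choices xss λ i → xss! (suc i))

  length-choices : ∀ {n s} (xss : Vec (List A) n) → (∀ i → length (lookup xss i) ≡ s) → length (choices xss) ≡ s ^ n
  length-choices [] _ = refl
  length-choices (xs ∷ xss) ≡s = trans (length-cartesianProductWith _∷_ xs (choices xss))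
    (cong₂ _*_ (≡s zero) (length-choices xss λ i → ≡s (suc i)))

module Fibers {A S : Set} (_≟_ : DecidableEquality S) (f : A → S) where

  fiber : S → List A → List A
  fiber y = filter (λ a → f a ≟ y)

  ∈-fiber⁺ : ∀ {y a xs} → a ∈ xs → f a ≡ y → a ∈ fiber y xs
  ∈-fiber⁺ = ∈-filter⁺ (λ a → f a ≟ _)

  ∈-fiber⁻ : ∀ {y a} xs → a ∈ fiber y xs → a ∈ xs × f a ≡ y
  ∈-fiber⁻ xs = ∈-filter⁻ (λ a → f a ≟ _) {xs = xs}

  Unique-fiber : ∀ {y xs} → Unique xs → Unique (fiber y xs)
  Unique-fiber = Unique.filter⁺ (λ a → f a ≟ _)

  length-fibers : ∀ {xs ys} → Unique xs → Unique ys → (∀ {a} → a ∈ xs → f a ∈ ys) →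
    length xs ≡ length (concatMap (λ y → fiber y xs) ys)
  length-fibers {xs} {ys} xs! ys! f[xs]⊆ys = Unique⇒length≡ xs!
    (Unique-concatMap _ ys! (λ _ → Unique-fiber xs!)
      λ a∈fy a∈fy′ → trans (sym (proj₂ (∈-fiber⁻ xs a∈fy))) (proj₂ (∈-fiber⁻ xs a∈fy′)))
    (λ a∈xs → ∈-concatMap⁺ (λ y → fiber y xs) (lose (f[xs]⊆ys a∈xs) (∈-fiber⁺ a∈xs refl)))
    (λ a∈ → let _ , _ , a∈fy = find (∈-concatMap⁻ (λ y → fiber y xs) {xs = ys} a∈) in proj₁ (∈-fiber⁻ xs a∈fy))

  equal-fibers⇒length≡ : ∀ {xs ys K} → Unique xs → Unique ys → (∀ {a} → a ∈ xs → f a ∈ ys) →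
    (∀ {y} → y ∈ ys → length (fiber y xs) ≡ K) → length xs ≡ length ys * K
  equal-fibers⇒length≡ {ys = ys} xs! ys! f[xs]⊆ys fibers≡K =
    trans (length-fibers xs! ys! f[xs]⊆ys) (length-concatMap-const _ ys fibers≡K)

  fiber-length≤ : ∀ {xs y y′} (g : A → A) → Unique xs → (∀ a → a ∈ xs) →
    (∀ {a b} → g a ≡ g b → a ≡ b) → (∀ a → f a ≡ y → f (g a) ≡ y′) →
    length (fiber y xs) ≤ length (fiber y′ xs)
  fiber-length≤ {xs} {y} {y′} g xs! all∈xs g-injective g[y]⊆y′ = ≤-trans
    (≤-reflexive (sym (length-map g (fiber y xs))))
    (Unique⇒length≤ (Unique.map⁺ g-injective (Unique-fiber xs!)) λ b∈ →
      let a , a∈fy , b≡ga = ∈-map⁻ g b∈ in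
      subst (_∈ fiber y′ xs) (sym b≡ga) (∈-fiber⁺ (all∈xs _) (g[y]⊆y′ a (proj₂ (∈-fiber⁻ xs a∈fy)))))

lookup-extensionality : ∀ {A : Set} {n} (xs ys : Vec A n) → (∀ i → lookup xs i ≡ lookup ys i) → xs ≡ ys
lookup-extensionality xs ys xs≗ys =
  trans (sym (Vecₚ.tabulate∘lookup xs)) (trans (Vecₚ.tabulate-cong xs≗ys) (Vecₚ.tabulate∘lookup ys))

lookup-map-allFin : ∀ {A : Set} {n} (f : Fin n → A) i → lookup (V.map f (allFin n)) i ≡ f i
lookup-map-allFin f i = trans (Vecₚ.lookup-map i f (allFin _)) (cong f (Vecₚ.lookup-allFin i))

concat-injective : ∀ {A : Set} {m n} (xss yss : Vec (Vec A m) n) → concat xss ≡ concat yss → xss ≡ yss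
concat-injective []         []         _  = refl
concat-injective (xs ∷ xss) (ys ∷ yss) eq =
  cong₂ _∷_ (Vecₚ.++-injectiveˡ xs ys eq) (concat-injective xss yss (Vecₚ.++-injectiveʳ xs ys eq))

update-agree : ∀ {A : Set} {n} (x y : Vec A n) i → (∀ l → l ≢ i → lookup x l ≡ lookup y l) → x [ i ]≔ lookup y i ≡ y
update-agree x y i agree = lookup-extensionality _ y λ l → lookup-update l
  where
    lookup-update : ∀ l → lookup (x [ i ]≔ lookup y i) l ≡ lookup y l
    lookup-update l with l F.≟ i
    ... | yes refl = Vecₚ.lookup∘update l x (lookup y i)
    ... | no l≢i   = trans (Vecₚ.lookup∘update′ l≢i x (lookup y i)) (agree l l≢i)

module ZqVectors (q : ℕ) .{{_ : NonZero q}} where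

  residue : ℕ → Fin q
  residue a = fromℕ< (m%n<n a q)

  residue-mod : ∀ a → toℕ (residue a) ≡ a mod q
  residue-mod a = mod-trans (≡⇒mod (toℕ-fromℕ< (m%n<n a q))) (%-mod q a)

  toℕ-residue-< : ∀ {a} → a < q → toℕ (residue a) ≡ a
  toℕ-residue-< a<q = mod-<⇒≡ q (residue-mod _) (toℕ<n _) a<q

  infixl 10 _!_
  _!_ : ∀ {n} → Vec (Fin q) n → Fin n → ℕ
  x ! i = toℕ (lookup x i)

  infixl 6 _⊕_

  _⊕_ : ∀ {n} → Vec (Fin q) n → Vec (Fin q) n → Vec (Fin q) n
  _⊕_ = V.zipWith λ x y → residue (toℕ x + toℕ y)

  ⊖_ : ∀ {n} → Vec (Fin q) n → Vec (Fin q) n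
  ⊖_ = V.map λ x → residue (q ∸ toℕ x)

  0⃗ : ∀ {n} → Vec (Fin q) n
  0⃗ = V.replicate _ (residue 0)

  toℕ-residue-0 : toℕ (residue 0) ≡ 0
  toℕ-residue-0 = toℕ-residue-< (>-nonZero⁻¹ q)

  mod⇒≡ : ∀ {x y : Fin q} → toℕ x ≡ toℕ y mod q → x ≡ y
  mod⇒≡ x≡y = toℕ-injective (mod-<⇒≡ q x≡y (toℕ<n _) (toℕ<n _))

  ⊕-cancelʳ : ∀ {n} (c : Vec (Fin q) n) {a b} → a ⊕ c ≡ b ⊕ c → a ≡ b
  ⊕-cancelʳ [] {[]} {[]} _ = refl
  ⊕-cancelʳ (z ∷ c) {x ∷ a} {y ∷ b} eq = cong₂ _∷_ (mod⇒≡ (mod-cancel-+ˡ (toℕ z) (begin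
      toℕ z + toℕ x              ≡⟨ +-comm (toℕ z) (toℕ x) ⟩
      toℕ x + toℕ z              ≈⟨ residue-mod _ ⟨
      toℕ (residue (toℕ x + toℕ z)) ≡⟨ cong toℕ (Vecₚ.∷-injectiveˡ eq) ⟩
      toℕ (residue (toℕ y + toℕ z)) ≈⟨ residue-mod _ ⟩
      toℕ y + toℕ z              ≡⟨ +-comm (toℕ y) (toℕ z) ⟩
      toℕ z + toℕ y              ∎)))
    (⊕-cancelʳ c (Vecₚ.∷-injectiveʳ eq))
    where open ≡-mod-Reasoning q

  ⊕-identityˡ : ∀ {n} (c : Vec (Fin q) n) → 0⃗ ⊕ c ≡ c
  ⊕-identityˡ [] = refl
  ⊕-identityˡ (z ∷ c) = cong₂ _∷_ (mod⇒≡ (begin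
      toℕ (residue (toℕ (residue 0) + toℕ z)) ≈⟨ residue-mod _ ⟩
      toℕ (residue 0) + toℕ z                 ≡⟨ cong (_+ toℕ z) toℕ-residue-0 ⟩
      toℕ z                                   ∎))
    (⊕-identityˡ c)
    where open ≡-mod-Reasoning q

  ⊕-inverseʳ : ∀ {n} (c : Vec (Fin q) n) → c ⊕ ⊖ c ≡ 0⃗
  ⊕-inverseʳ [] = refl
  ⊕-inverseʳ (z ∷ c) = cong₂ _∷_ (mod⇒≡ (begin
      toℕ (residue (toℕ z + toℕ (residue (q ∸ toℕ z)))) ≈⟨ residue-mod _ ⟩
      toℕ z + toℕ (residue (q ∸ toℕ z))               ≈⟨ mod-+ (mod-refl {a = toℕ z}) (residue-mod _) ⟩
      toℕ z + (q ∸ toℕ z)                             ≡⟨ m+[n∸m]≡n (<⇒≤ (toℕ<n z)) ⟩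
      q                                               ≈⟨ mod-self ⟩
      0                                               ≡⟨ toℕ-residue-0 ⟨
      toℕ (residue 0)                                 ∎))
    (⊕-inverseʳ c)
    where open ≡-mod-Reasoning q

  dot : ∀ {n} → Vec ℕ n → Vec (Fin q) n → ℕ
  dot [] [] = 0
  dot (r ∷ rs) (x ∷ xs) = r * toℕ x + dot rs xs

  dot-⊕ : ∀ {n} (r : Vec ℕ n) a c → dot r (a ⊕ c) ≡ dot r a + dot r c mod q
  dot-⊕ [] [] [] = mod-refl
  dot-⊕ (r ∷ rs) (x ∷ a) (z ∷ c) = begin
    r * toℕ (residue (toℕ x + toℕ z)) + dot rs (a ⊕ c)   ≈⟨ mod-+ (mod-*ˡ r (residue-mod _)) (dot-⊕ rs a c) ⟩
    r * (toℕ x + toℕ z) + (dot rs a + dot rs c)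
      ≡⟨ solve 5 (λ r x z d e → r :* (x :+ z) :+ (d :+ e) := (r :* x :+ d) :+ (r :* z :+ e))
               refl r (toℕ x) (toℕ z) (dot rs a) (dot rs c) ⟩
    (r * toℕ x + dot rs a) + (r * toℕ z + dot rs c)      ∎
    where open ≡-mod-Reasoning q

  dot-0⃗ : ∀ {n} (r : Vec ℕ n) → dot r 0⃗ ≡ 0
  dot-0⃗ [] = refl
  dot-0⃗ (r ∷ rs) = cong₂ _+_ (trans (cong (r *_) toℕ-residue-0) (*-zeroʳ r)) (dot-0⃗ rs)

  vectors : ∀ n → List (Vec (Fin q) n)
  vectors n = choices (V.replicate n (L.allFin q))

  ∈-vectors : ∀ {n} (v : Vec (Fin q) n) → v ∈ vectors n
  ∈-vectors v = ∈-choices⁺ (V.replicate _ (L.allFin q)) v λ i →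
    subst (lookup v i ∈_) (sym (Vecₚ.lookup-replicate i (L.allFin q))) (∈-allFin (lookup v i))

  Unique-vectors : ∀ n → Unique (vectors n)
  Unique-vectors n = Unique-choices (V.replicate n (L.allFin q)) λ i →
    subst Unique (sym (Vecₚ.lookup-replicate i (L.allFin q))) (Unique.allFin⁺ q)

  length-vectors : ∀ n → length (vectors n) ≡ q ^ n
  length-vectors n = length-choices (V.replicate n (L.allFin q)) λ i →
    trans (cong length (Vecₚ.lookup-replicate i (L.allFin q))) (length-tabulate {n = q} (λ x → x))

  unit : ∀ {n} → Fin n → Fin q → Vec (Fin q) n
  unit zero    x = x ∷ 0⃗
  unit (suc l) x = residue 0 ∷ unit l x

  dot-ones : ∀ {n} (r : Vec ℕ n) x → (∀ l → lookup r l ≡ 1) → dot r x ≡ V.sum (V.map toℕ x)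
  dot-ones []       []      _   = refl
  dot-ones (r ∷ rs) (a ∷ x) r≡1 =
    cong₂ _+_ (trans (cong (_* toℕ a) (r≡1 zero)) (*-identityˡ _)) (dot-ones rs x (r≡1 ∘ suc))

  dot-unit : ∀ {n} (r : Vec ℕ n) l x → dot r (unit l x) ≡ lookup r l * toℕ x
  dot-unit (r ∷ rs) zero    x = trans (cong (r * toℕ x +_) (dot-0⃗ rs)) (+-identityʳ _)
  dot-unit (r ∷ rs) (suc l) x =
    trans (cong (_+ dot rs (unit l x)) (trans (cong (r *_) toℕ-residue-0) (*-zeroʳ r))) (dot-unit rs l x)

  dot-multiple : ∀ {n} d (r : Vec ℕ n) h → (∀ l → ∃ λ a → lookup r l ≡ d * a) → ∃ λ X → dot r h ≡ d * X
  dot-multiple d [] [] _ = 0 , sym (*-zeroʳ d)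
  dot-multiple d (r ∷ rs) (x ∷ h) r≡d* with r≡d* zero | dot-multiple d rs h (r≡d* ∘ suc)
  ... | a , refl | X , dot≡dX = a * toℕ x + X , (begin
    d * a * toℕ x + dot rs h   ≡⟨ cong (d * a * toℕ x +_) dot≡dX ⟩
    d * a * toℕ x + d * X
      ≡⟨ solve 4 (λ d a x X → d :* a :* x :+ d :* X := d :* (a :* x :+ X)) refl d a (toℕ x) X ⟩
    d * (a * toℕ x + X)        ∎)
    where open ≡-Reasoning

  dot-update : ∀ {n} (r : Vec ℕ n) x i a →
    dot r (x [ i ]≔ a) + lookup r i * toℕ (lookup x i) ≡ dot r x + lookup r i * toℕ a
  dot-update (r ∷ rs) (b ∷ x) zero a =
    solve 4 (λ r a d b → r :* a :+ d :+ r :* b := r :* b :+ d :+ r :* a) refl r (toℕ a) (dot rs x) (toℕ b)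
  dot-update (r ∷ rs) (b ∷ x) (suc i) a = begin
    r * toℕ b + dot rs (x [ i ]≔ a) + lookup rs i * toℕ (lookup x i)   ≡⟨ +-assoc (r * toℕ b) _ _ ⟩
    r * toℕ b + (dot rs (x [ i ]≔ a) + lookup rs i * toℕ (lookup x i))
      ≡⟨ cong (r * toℕ b +_) (dot-update rs x i a) ⟩
    r * toℕ b + (dot rs x + lookup rs i * toℕ a)                        ≡⟨ +-assoc (r * toℕ b) _ _ ⟨
    r * toℕ b + dot rs x + lookup rs i * toℕ a                          ∎
    where open ≡-Reasoning

tabulate-injective : ∀ {A : Set} {n} {f g : Fin n → A} → tabulate f ≡ tabulate g → ∀ t → f t ≡ g t
tabulate-injective {n = suc n} eq zero = Listₚ.∷-injectiveˡ eq
tabulate-injective {n = suc n} eq (suc t) = tabulate-injective (Listₚ.∷-injectiveʳ eq) t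

module Syndrome (q : ℕ) .{{_ : NonZero q}} {n R : ℕ} (row : Fin R → Vec ℕ n) where

  open ZqVectors q

  syndrome : Vec (Fin q) n → List ℕ
  syndrome h = tabulate λ t → dot (row t) h % q

  syndrome-≡⇒mod : ∀ {a b} → syndrome a ≡ syndrome b → ∀ t → dot (row t) a ≡ dot (row t) b mod q
  syndrome-≡⇒mod sa≡sb t = %≡⇒mod q (tabulate-injective sa≡sb t)

  syndrome-⊕ : ∀ {a b} c → syndrome a ≡ syndrome b → syndrome (a ⊕ c) ≡ syndrome (b ⊕ c)
  syndrome-⊕ {a} {b} c sa≡sb = tabulate-cong λ t → mod⇒%≡ q (begin
    dot (row t) (a ⊕ c)            ≈⟨ dot-⊕ (row t) a c ⟩
    dot (row t) a + dot (row t) c  ≈⟨ mod-+ (syndrome-≡⇒mod sa≡sb t) mod-refl ⟩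
    dot (row t) b + dot (row t) c  ≈⟨ dot-⊕ (row t) b c ⟨
    dot (row t) (b ⊕ c)            ∎)
    where open ≡-mod-Reasoning q

  open Fibers (Listₚ.≡-dec _≟_) syndrome public

  kernel : List (Vec (Fin q) n)
  kernel = fiber (syndrome 0⃗) (vectors n)

  fiber≡kernel : ∀ c → length (fiber (syndrome c) (vectors n)) ≡ length kernel
  fiber≡kernel c = sym (≤-antisym
    (fiber-length≤ (_⊕ c) (Unique-vectors n) ∈-vectors (⊕-cancelʳ c)
      λ a sa≡s0 → trans (syndrome-⊕ c sa≡s0) (cong syndrome (⊕-identityˡ c)))
    (fiber-length≤ (_⊕ ⊖ c) (Unique-vectors n) ∈-vectors (⊕-cancelʳ (⊖ c))
      λ a sa≡sc → trans (syndrome-⊕ (⊖ c) sa≡sc) (cong syndrome (⊕-inverseʳ c))))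

  q^n≡image*kernel : ∀ {Y} → Unique Y → (∀ h → syndrome h ∈ Y) → (∀ {y} → y ∈ Y → ∃ λ c → syndrome c ≡ y) →
    q ^ n ≡ length Y * length kernel
  q^n≡image*kernel Y! image⊆Y Y⊆image = trans (sym (length-vectors n))
    (equal-fibers⇒length≡ (Unique-vectors n) Y! (λ {h} _ → image⊆Y h)
      λ y∈Y → let c , sc≡y = Y⊆image y∈Y in
        subst (λ y → length (fiber y (vectors n)) ≡ length kernel) sc≡y (fiber≡kernel c))

record IsSubgroup (q : ℕ) (S : List ℕ) : Set where
  field
    d e : ℕ
    {{d≢0}} : NonZero d
    {{e≢0}} : NonZero e
    d*e≡q : d * e ≡ q
    S≡dℤ : S ≡ map (d *_) (upTo e)

module IsSubgroupProperties {q : ℕ} {S : List ℕ} (P : IsSubgroup q S) where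

  open IsSubgroup P

  0∈ : 0 ∈ S
  0∈ rewrite S≡dℤ = subst (_∈ map (d *_) (upTo e)) (*-zeroʳ d) (∈-map⁺ (d *_) (∈-upTo⁺ (>-nonZero⁻¹ e)))

  ∈⇒multiple : ∀ {x} → x ∈ S → ∃ λ a → x ≡ d * a
  ∈⇒multiple x∈S rewrite S≡dℤ = let a , _ , x≡da = ∈-map⁻ (d *_) x∈S in a , x≡da

  ∈⇒< : ∀ {x} → x ∈ S → x < q
  ∈⇒< x∈S rewrite S≡dℤ = let a , a∈ , x≡da = ∈-map⁻ (d *_) x∈S in
    subst₂ _<_ (sym x≡da) d*e≡q (*-monoʳ-< d (∈-upTo⁻ a∈))

  multiple-representative : ∀ X → ∃ λ y → y ∈ S × y ≡ d * X mod q
  multiple-representative X rewrite S≡dℤ =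
    d * (X % e) , ∈-map⁺ (d *_) (∈-upTo⁺ (m%n<n X e)) , X / e , 0 , (begin
      d * (X % e) + X / e * q          ≡⟨ cong (λ z → d * (X % e) + X / e * z) (sym d*e≡q) ⟩
      d * (X % e) + X / e * (d * e)
        ≡⟨ solve 4 (λ d r u e → d :* r :+ u :* (d :* e) := d :* (r :+ u :* e)) refl d (X % e) (X / e) e ⟩
      d * (X % e + X / e * e)          ≡⟨ cong (d *_) (sym (m≡m%n+[m/n]*n X e)) ⟩
      d * X                            ≡⟨ +-identityʳ _ ⟨
      d * X + 0 * q                    ∎)
    where open ≡-Reasoning

  unique : Unique S
  unique rewrite S≡dℤ = Unique.map⁺ (*-cancelˡ-≡ _ _ d) (Unique.upTo⁺ e)

entry-∈ : ∀ {xs Ss} → Pointwise _∈_ xs Ss → (t : Fin (length Ss)) → entry xs (toℕ t) ∈ L.lookup Ss t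
entry-∈ (x∈S ∷ _)   zero    = x∈S
entry-∈ (_ ∷ xs∈Ss) (suc t) = entry-∈ xs∈Ss t

entry-replicate-0 : ∀ m t → entry (replicate m 0) t ≡ 0
entry-replicate-0 zero    t       = refl
entry-replicate-0 (suc m) zero    = refl
entry-replicate-0 (suc m) (suc t) = entry-replicate-0 m t

tabulate-entry : ∀ {m} {f : Fin m → ℕ} xs → length xs ≡ m → (∀ t → f t ≡ entry xs (toℕ t)) → tabulate f ≡ xs
tabulate-entry {zero}  []       _     _  = refl
tabulate-entry {suc m} (x ∷ xs) len≡ f≡ =
  cong₂ _∷_ (f≡ zero) (tabulate-entry xs (suc-injective len≡) (f≡ ∘ suc))

Pointwise-tabulate : ∀ {A B : Set} {R : A → B → Set} {ys : List B} (f : Fin (length ys) → A) →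
  (∀ t → R (f t) (L.lookup ys t)) → Pointwise R (tabulate f) ys
Pointwise-tabulate {ys = []}    f _  = []
Pointwise-tabulate {ys = _ ∷ _} f Rf = Rf zero ∷ Pointwise-tabulate (λ t → f (suc t)) (λ t → Rf (suc t))

Unique-lookup-injective : ∀ {A : Set} {xs : List A} → Unique xs → ∀ i j → L.lookup xs i ≡ L.lookup xs j → i ≡ j
Unique-lookup-injective (_ ∷ _)      zero    zero    _  = refl
Unique-lookup-injective (x∉xs ∷ _)  zero    (suc j) eq = contradiction eq (All.lookup x∉xs (∈-lookup j))
Unique-lookup-injective (x∉xs ∷ _)  (suc i) zero    eq = contradiction (sym eq) (All.lookup x∉xs (∈-lookup i))
Unique-lookup-injective (_ ∷ xs!)   (suc i) (suc j) eq = cong suc (Unique-lookup-injective xs! i j eq)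

entry-extensionality : ∀ {R} xs ys → length xs ≡ R → length ys ≡ R →
  (∀ (t : Fin R) → entry xs (toℕ t) ≡ entry ys (toℕ t)) → xs ≡ ys
entry-extensionality {zero}  []       []       _    _    _  = refl
entry-extensionality {suc R} (x ∷ xs) (y ∷ ys) len≡ len≡′ x≗y = cong₂ _∷_ (x≗y zero)
  (entry-extensionality xs ys (suc-injective len≡) (suc-injective len≡′) (λ t → x≗y (suc t)))

rowOf : (cols : List (List ℕ)) → ℕ → Vec ℕ (length cols)
rowOf cols t = V.tabulate λ l → entry (L.lookup cols l) t

-- H_I is the instance q = 2^k, Sᵢ = 2^{k−j} Z_{2^k}.
module LinearCode (q : ℕ) .{{_ : NonZero q}} (1<q : 1 < q) (rest : List (List ℕ))
                  (subgroups : All (IsSubgroup q) rest) where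

  open ZqVectors q

  alphabets : List (List ℕ)
  alphabets = [ 1 ] ∷ rest

  cols : List (List ℕ)
  cols = tuples alphabets

  n : ℕ
  n = length cols

  R : ℕ
  R = length alphabets

  row : Fin R → Vec ℕ n
  row t = rowOf cols (toℕ t)

  open Syndrome q row public

  IsCodeword : Vec (Fin q) n → Set
  IsCodeword h = ∀ t → t < R → q ∣ sum (zipWith (λ b x → entry b t * x) cols (toList (V.map toℕ h)))

  Orthogonal : Vec (Fin q) n → Set
  Orthogonal h = ∀ t → dot (row t) h ≡ 0 mod q

  sum-zipWith≡dot : ∀ t cs (h : Vec (Fin q) (length cs)) →
    sum (zipWith (λ b x → entry b t * x) cs (toList (V.map toℕ h))) ≡ dot (rowOf cs t) h
  sum-zipWith≡dot t []       []      = refl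
  sum-zipWith≡dot t (b ∷ cs) (x ∷ h) = cong (entry b t * toℕ x +_) (sum-zipWith≡dot t cs h)

  lookup-row : ∀ t l → lookup (row t) l ≡ entry (L.lookup cols l) (toℕ t)
  lookup-row t l = Vecₚ.lookup∘tabulate _ l

  column-∈ : ∀ l → Pointwise _∈_ (L.lookup cols l) alphabets
  column-∈ l = ∈-tuples⁻ alphabets (∈-lookup l)

  alphabet-< : ∀ t {x} → x ∈ L.lookup alphabets t → x < q
  alphabet-< zero    (here refl) = 1<q
  alphabet-< (suc t) x∈S = IsSubgroupProperties.∈⇒< (All.lookup subgroups (∈-lookup t)) x∈S

  row-< : ∀ t l → lookup (row t) l < q
  row-< t l = subst (_< q) (sym (lookup-row t l)) (alphabet-< t (entry-∈ (column-∈ l) t))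

  row-zero : ∀ l → lookup (row zero) l ≡ 1
  row-zero l = trans (lookup-row zero l) (head≡1 (column-∈ l))
    where head≡1 : ∀ {b} → Pointwise _∈_ b alphabets → entry b 0 ≡ 1
          head≡1 (here refl ∷ _) = refl

  codeword⇒orthogonal : ∀ {h} → IsCodeword h → Orthogonal h
  codeword⇒orthogonal {h} h∈C t =
    ∣⇒mod0 q (subst (q ∣_) (sum-zipWith≡dot (toℕ t) cols h) (h∈C (toℕ t) (toℕ<n t)))

  orthogonal⇒codeword : ∀ {h} → Orthogonal h → IsCodeword h
  orthogonal⇒codeword {h} h⊥ t t<R = subst (q ∣_) (sym (sum-zipWith≡dot t cols h))
    (subst (λ t → q ∣ dot (rowOf cols t) h) (toℕ-fromℕ< t<R) (mod0⇒∣ q (h⊥ (fromℕ< t<R))))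

  orthogonal⇒∈kernel : ∀ {h} → Orthogonal h → h ∈ kernel
  orthogonal⇒∈kernel {h} h⊥ = ∈-fiber⁺ (∈-vectors h) (tabulate-cong λ t →
    mod⇒%≡ q (mod-trans (h⊥ t) (≡⇒mod (sym (dot-0⃗ (row t))))))

  ∈kernel⇒orthogonal : ∀ {h} → h ∈ kernel → Orthogonal h
  ∈kernel⇒orthogonal {h} h∈K t =
    mod-trans (syndrome-≡⇒mod (proj₂ (∈-fiber⁻ (vectors n) h∈K)) t)
      (≡⇒mod (dot-0⃗ (row t)))

  Unique-kernel : Unique kernel
  Unique-kernel = Unique-fiber (Unique-vectors n)

  ∈kernel⇔codeword : ∀ h → h ∈ kernel ⇔ IsCodeword h
  ∈kernel⇔codeword h = mk⇔ (orthogonal⇒codeword ∘ ∈kernel⇒orthogonal) (orthogonal⇒∈kernel ∘ codeword⇒orthogonal)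

  image : List (List ℕ)
  image = tuples (upTo q ∷ rest)

  Unique-image : Unique image
  Unique-image = Unique-tuples (Unique.upTo⁺ q ∷ All.map IsSubgroupProperties.unique subgroups)

  length-image : length image ≡ q * n
  length-image = trans (length-tuples (upTo q ∷ rest))
    (cong₂ _*_ (length-upTo q) (sym (trans (length-tuples alphabets) (*-identityˡ _))))

  syndrome-∈-image : ∀ h → syndrome h ∈ image
  syndrome-∈-image h = ∈-tuples⁺ (∈-upTo⁺ (m%n<n _ q) ∷ Pointwise-tabulate {ys = rest} _ entry∈subgroup)
    where
      entry∈subgroup : ∀ t → dot (row (suc t)) h % q ∈ L.lookup rest t
      entry∈subgroup t =
        let S = All.lookup subgroups (∈-lookup t)
            open IsSubgroupProperties S
            X , dot≡dX = dot-multiple (IsSubgroup.d S) (row (suc t)) h λ l →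
              ∈⇒multiple (subst (_∈ L.lookup rest t) (sym (lookup-row (suc t) l)) (entry-∈ (column-∈ l) (suc t)))
            y , y∈S , y≡dX = multiple-representative X
        in subst (_∈ L.lookup rest t)
             (sym (mod-<⇒%≡ q (mod-trans (≡⇒mod dot≡dX) (mod-sym y≡dX)) (∈⇒< y∈S))) y∈S

  dot-unit-column : ∀ {b} (b∈ : b ∈ cols) t x → dot (row t) (unit (index b∈) x) ≡ entry b (toℕ t) * toℕ x
  dot-unit-column b∈ t x = trans (dot-unit (row t) (index b∈) x)
    (cong (_* toℕ x) (trans (lookup-row t (index b∈)) (cong (λ b → entry b (toℕ t)) (sym (lookup-index b∈)))))

  zeros-∈ : ∀ {Ss} → All (IsSubgroup q) Ss → Pointwise _∈_ (replicate (length Ss) 0) Ss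
  zeros-∈ []       = []
  zeros-∈ (S ∷ Ss) = IsSubgroupProperties.0∈ S ∷ zeros-∈ Ss

  -- The preimage of (a, g) is e_{(1,g)} + (a − 1)·e_{(1,0,…,0)}, with a − 1 written as a + (q ∸ 1).
  image-⊆-syndromes : ∀ {y} → y ∈ image → ∃ λ c → syndrome c ≡ y
  image-⊆-syndromes y∈ with ∈-tuples⁻ (upTo q ∷ rest) y∈
  ... | _∷_ {x = a} {xs = g} a∈ g∈rest =
    c , tabulate-entry (a ∷ g) (cong suc (Pointwise-length g∈rest)) syndrome-entry
    where
      zeros = replicate (length rest) 0
      col₁ = ∈-tuples⁺ {Ss = alphabets} (here refl ∷ g∈rest)
      col₀ = ∈-tuples⁺ {Ss = alphabets} (here refl ∷ zeros-∈ subgroups)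
      c = unit (index col₁) (residue 1) ⊕ unit (index col₀) (residue (a + (q ∸ 1)))

      dot-c : ∀ t → dot (row t) c ≡ entry (1 ∷ g) (toℕ t) + entry (1 ∷ zeros) (toℕ t) * (a + (q ∸ 1)) mod q
      dot-c t = begin
        dot (row t) c                                                              ≈⟨ dot-⊕ (row t) _ _ ⟩
        dot (row t) (unit (index col₁) (residue 1)) + dot (row t) (unit (index col₀) (residue (a + (q ∸ 1))))
          ≈⟨ ≡⇒mod (cong₂ _+_ (dot-unit-column col₁ t _) (dot-unit-column col₀ t _)) ⟩
        entry (1 ∷ g) (toℕ t) * toℕ (residue 1) + entry (1 ∷ zeros) (toℕ t) * toℕ (residue (a + (q ∸ 1)))
          ≈⟨ mod-+ (≡⇒mod (trans (cong (entry (1 ∷ g) (toℕ t) *_) (toℕ-residue-< 1<q)) (*-identityʳ _)))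
                   (mod-*ˡ (entry (1 ∷ zeros) (toℕ t)) (residue-mod _)) ⟩
        entry (1 ∷ g) (toℕ t) + entry (1 ∷ zeros) (toℕ t) * (a + (q ∸ 1)) ∎
        where open ≡-mod-Reasoning q

      syndrome-entry : ∀ t → dot (row t) c % q ≡ entry (a ∷ g) (toℕ t)
      syndrome-entry zero = mod-<⇒%≡ q (mod-trans (dot-c zero) (begin
        1 + (a + (q ∸ 1) + 0)  ≡⟨ cong (1 +_) (+-identityʳ _) ⟩
        1 + (a + (q ∸ 1))      ≡⟨ solve 3 (λ a o r → o :+ (a :+ r) := a :+ (o :+ r)) refl a 1 (q ∸ 1) ⟩
        a + (1 + (q ∸ 1))      ≡⟨ cong (a +_) (m+[n∸m]≡n (<⇒≤ 1<q)) ⟩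
        a + q                  ≈⟨ mod-+ (mod-refl {a = a}) mod-self ⟩
        a + 0                  ≡⟨ +-identityʳ a ⟩
        a                      ∎)) (∈-upTo⁻ a∈)
        where open ≡-mod-Reasoning q
      syndrome-entry (suc t) = mod-<⇒%≡ q
        (mod-trans (dot-c (suc t)) (≡⇒mod (trans
          (cong (λ z → entry g (toℕ t) + z * (a + (q ∸ 1))) (entry-replicate-0 (length rest) (toℕ t)))
          (+-identityʳ _))))
        (alphabet-< (suc t) (entry-∈ g∈rest t))

  q^n≡qn*|kernel| : q ^ n ≡ q * n * length kernel
  q^n≡qn*|kernel| = trans (q^n≡image*kernel Unique-image syndrome-∈-image image-⊆-syndromes)
    (cong (_* length kernel) length-image)

  Unique-cols : Unique cols
  Unique-cols = Unique-tuples ((([] ∷ [])) ∷ All.map IsSubgroupProperties.unique subgroups)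

  rows-agree⇒≡ : ∀ i j → (∀ t → lookup (row t) i ≡ lookup (row t) j) → i ≡ j
  rows-agree⇒≡ i j rows≡ = Unique-lookup-injective Unique-cols i j (entry-extensionality _ _
    (Pointwise-length (column-∈ i)) (Pointwise-length (column-∈ j))
    λ t → trans (sym (lookup-row t i)) (trans (rows≡ t) (lookup-row t j)))

  dot-row-zero : ∀ x → dot (row zero) x ≡ V.sum (V.map toℕ x)
  dot-row-zero x = dot-ones (row zero) x row-zero

  orthogonal-cancel : ∀ {x x′} → Orthogonal x → Orthogonal x′ →
    ∀ t A B → dot (row t) x′ + A ≡ dot (row t) x + B → A ≡ B mod q
  orthogonal-cancel {x} {x′} x⊥ x′⊥ t A B eq = begin
    A                       ≡⟨⟩
    0 + A                   ≈⟨ mod-+ (mod-sym (x′⊥ t)) mod-refl ⟩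
    dot (row t) x′ + A      ≡⟨ eq ⟩
    dot (row t) x + B       ≈⟨ mod-+ (x⊥ t) mod-refl ⟩
    B                       ∎
    where open ≡-mod-Reasoning q

  agree-except-one⇒agree : ∀ {x x′} → Orthogonal x → Orthogonal x′ → ∀ i →
    (∀ l → l ≢ i → lookup x l ≡ lookup x′ l) → lookup x i ≡ lookup x′ i
  agree-except-one⇒agree {x} {x′} x⊥ x′⊥ i agree = mod⇒≡ (begin
    x ! i        ≡⟨ *-identityˡ _ ⟨
    1 * x ! i    ≡⟨ cong (_* x ! i) (row-zero i) ⟨
    rᵢ * x ! i   ≈⟨ orthogonal-cancel x⊥ x′⊥ zero _ _ exchange ⟩
    rᵢ * x′ ! i  ≡⟨ cong (_* x′ ! i) (row-zero i) ⟩
    1 * x′ ! i   ≡⟨ *-identityˡ _ ⟩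
    x′ ! i       ∎)
    where
      open ≡-mod-Reasoning q
      r = row zero
      rᵢ = lookup r i
      exchange : dot r x′ + rᵢ * x ! i ≡ dot r x + rᵢ * x′ ! i
      exchange = subst (λ z → dot r z + rᵢ * x ! i ≡ dot r x + rᵢ * x′ ! i) (update-agree x x′ i agree)
        (dot-update r x i (lookup x′ i))

  agree-except-two⇒row-relation : ∀ {x x′} → Orthogonal x → Orthogonal x′ → ∀ {i j} → i ≢ j →
    (∀ l → l ≢ i → l ≢ j → lookup x l ≡ lookup x′ l) → ∀ t → let r = row t in
    lookup r i * x ! i + lookup r j * x ! j ≡ lookup r i * x′ ! i + lookup r j * x′ ! j mod q
  agree-except-two⇒row-relation {x} {x′} x⊥ x′⊥ {i} {j} i≢j agree t =
    orthogonal-cancel x⊥ x′⊥ t _ _ (begin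
      dot r x′ + (rᵢ * x ! i + rⱼ * x ! j)  ≡⟨ +-assoc (dot r x′) _ _ ⟨
      dot r x′ + rᵢ * x ! i + rⱼ * x ! j    ≡⟨ xy+z≡xz+y (dot r x′) _ _ ⟩
      dot r x′ + rⱼ * x ! j + rᵢ * x ! i    ≡⟨ cong (_+ rᵢ * x ! i) step₂ ⟩
      dot r x₁ + rⱼ * x′ ! j + rᵢ * x ! i   ≡⟨ xy+z≡xz+y (dot r x₁) _ _ ⟩
      dot r x₁ + rᵢ * x ! i + rⱼ * x′ ! j   ≡⟨ cong (_+ rⱼ * x′ ! j) step₁ ⟩
      dot r x + rᵢ * x′ ! i + rⱼ * x′ ! j   ≡⟨ +-assoc (dot r x) _ _ ⟩
      dot r x + (rᵢ * x′ ! i + rⱼ * x′ ! j) ∎)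
    where
      open ≡-Reasoning
      r = row t
      rᵢ = lookup r i
      rⱼ = lookup r j
      x₁ = x [ i ]≔ lookup x′ i
      x₁-agree : ∀ l → l ≢ j → lookup x₁ l ≡ lookup x′ l
      x₁-agree l l≢j with l F.≟ i
      ... | yes refl = Vecₚ.lookup∘update l x (lookup x′ l)
      ... | no l≢i   = trans (Vecₚ.lookup∘update′ l≢i x _) (agree l l≢i l≢j)
      step₁ : dot r x₁ + rᵢ * x ! i ≡ dot r x + rᵢ * x′ ! i
      step₁ = dot-update r x i (lookup x′ i)
      step₂ : dot r x′ + rⱼ * x ! j ≡ dot r x₁ + rⱼ * x′ ! j
      step₂ = subst₂ (λ z w → dot r z + rⱼ * toℕ w ≡ dot r x₁ + rⱼ * x′ ! j)
        (update-agree x₁ x′ j x₁-agree) (Vecₚ.lookup∘update′ (i≢j ∘ sym) x _) (dot-update r x₁ j (lookup x′ j))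

module _ {m q s : ℕ} (H : ℕ → Vec Bool m → Set) (H-size : ∀ j → j < q → HasSize (H j) s)
         (H-disjoint : ∀ j j′ w → j < q → j′ < q → H j w → H j′ w → j ≡ j′) where

  private
    list : Fin q → List (Vec Bool m)
    list a = proj₁ (H-size (toℕ a) (toℕ<n a))

    list! : ∀ a → Unique (list a)
    list! a = proj₁ (proj₂ (H-size (toℕ a) (toℕ<n a)))

    ∈list⇔ : ∀ a w → w ∈ list a ⇔ H (toℕ a) w
    ∈list⇔ a = proj₁ (proj₂ (proj₂ (H-size (toℕ a) (toℕ<n a))))

    |list| : ∀ a → length (list a) ≡ s
    |list| a = proj₂ (proj₂ (proj₂ (H-size (toℕ a) (toℕ<n a))))

    blocks : ∀ {n} → Vec (Fin q) n → List (Vec (Vec Bool m) n)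
    blocks x = choices (V.map list x)

    lookup-lists : ∀ {n} (x : Vec (Fin q) n) i → lookup (V.map list x) i ≡ list (lookup x i)
    lookup-lists x i = Vecₚ.lookup-map i list x

    ∈-blocks⇔ : ∀ {n} (x : Vec (Fin q) n) ys → ys ∈ blocks x ⇔ (∀ i → H (toℕ (lookup x i)) (lookup ys i))
    ∈-blocks⇔ x ys = mk⇔
      (λ ys∈ i → Equivalence.to (∈list⇔ (lookup x i) _)
        (subst (_ ∈_) (lookup-lists x i) (∈-choices⁻ (V.map list x) ys∈ i)))
      (λ ys∈H → ∈-choices⁺ (V.map list x) ys λ i →
        subst (_ ∈_) (sym (lookup-lists x i)) (Equivalence.from (∈list⇔ (lookup x i) _) (ys∈H i)))

    words : ∀ {n} → Vec (Fin q) n → List (Vec Bool (n * m))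
    words x = L.map concat (blocks x)

  Φ-size : ∀ {n} (C : Vec (Fin q) n → Set) (cs : List (Vec (Fin q) n)) → Unique cs → (∀ x → x ∈ cs ⇔ C x) →
    HasSize (Φ H C) (length cs * s ^ n)
  Φ-size {n} C cs cs! ∈cs⇔ = concatMap words cs , unique , ∈⇔ , length≡
    where
      words-disjoint : ∀ {x x′ y} → y ∈ words x → y ∈ words x′ → x ≡ x′
      words-disjoint {x} {x′} y∈ y∈′ with ∈-map⁻ concat y∈ | ∈-map⁻ concat y∈′
      ... | ys , ys∈ , refl | ys′ , ys′∈ , y≡ with concat-injective ys ys′ y≡
      ... | refl = lookup-extensionality x x′ λ i → toℕ-injective (H-disjoint _ _ _ (toℕ<n _) (toℕ<n _)
            (Equivalence.to (∈-blocks⇔ x ys) ys∈ i) (Equivalence.to (∈-blocks⇔ x′ ys) ys′∈ i))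

      unique : Unique (concatMap words cs)
      unique = Unique-concatMap words cs!
        (λ x → Unique.map⁺ (concat-injective _ _) (Unique-choices (V.map list x) λ i →
          subst Unique (sym (lookup-lists x i)) (list! (lookup x i))))
        words-disjoint

      ∈⇔ : ∀ y → y ∈ concatMap words cs ⇔ Φ H C y
      ∈⇔ y = mk⇔
        (λ y∈ → let x , x∈cs , y∈wx = find (∈-concatMap⁻ words {xs = cs} y∈)
                    ys , ys∈ , y≡ = ∈-map⁻ concat y∈wx
                in x , Equivalence.to (∈cs⇔ x) x∈cs , ys , y≡ , Equivalence.to (∈-blocks⇔ x ys) ys∈)
        (λ { (x , Cx , ys , refl , ys∈H) → ∈-concatMap⁺ words (lose (Equivalence.from (∈cs⇔ x) Cx)
               (∈-map⁺ concat (Equivalence.from (∈-blocks⇔ x ys) ys∈H))) })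

      length≡ : length (concatMap words cs) ≡ length cs * s ^ n
      length≡ = length-concatMap-const words cs λ {x} _ → trans (length-map concat (blocks x))
        (length-choices (V.map list x) λ i → trans (cong length (lookup-lists x i)) (|list| (lookup x i)))

p^k∣m*n∧p∤n⇒p^k∣m : ∀ {p} → Prime p → ∀ k e δ → p ^ k ∣ e * δ → ¬ p ∣ δ → p ^ k ∣ e
p^k∣m*n∧p∤n⇒p^k∣m pp zero e δ _ _ = 1∣ e
p^k∣m*n∧p∤n⇒p^k∣m {p} pp (suc k) e δ p^k+1∣eδ p∤δ
  with euclidsLemma e δ pp (∣-trans (m∣m*n (p ^ k)) p^k+1∣eδ)
... | inj₂ p∣δ = contradiction p∣δ p∤δ
... | inj₁ (divides e′ refl) = subst (p ^ suc k ∣_) (*-comm p e′) (*-monoʳ-∣ p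
  (p^k∣m*n∧p∤n⇒p^k∣m pp k e′ δ (*-cancelˡ-∣ p {{prime⇒nonZero pp}}
    (subst (p * p ^ k ∣_) (solve 3 (λ e p δ → e :* p :* δ := p :* (e :* δ)) refl e′ p δ) p^k+1∣eδ)) p∤δ))

dist-++ : ∀ {a b} (x y : Vec Bool a) (u v : Vec Bool b) → dist (x ++ u) (y ++ v) ≡ dist x y + dist u v
dist-++ []           []           u v = refl
dist-++ (true ∷ x)  (true ∷ y)  u v = dist-++ x y u v
dist-++ (false ∷ x) (false ∷ y) u v = dist-++ x y u v
dist-++ (true ∷ x)  (false ∷ y) u v = cong suc (dist-++ x y u v)
dist-++ (false ∷ x) (true ∷ y)  u v = cong suc (dist-++ x y u v)

weight-++ : ∀ {a b} (x : Vec Bool a) (u : Vec Bool b) → weight (x ++ u) ≡ weight x + weight u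
weight-++ []          u = refl
weight-++ (true ∷ x)  u = cong suc (weight-++ x u)
weight-++ (false ∷ x) u = weight-++ x u

dist-concat : ∀ {m n} (xs ys : Vec (Vec Bool m) n) → dist (concat xs) (concat ys) ≡ V.sum (V.zipWith dist xs ys)
dist-concat []       []       = refl
dist-concat (x ∷ xs) (y ∷ ys) =
  trans (dist-++ x y (concat xs) (concat ys)) (cong (dist x y +_) (dist-concat xs ys))

weight-concat : ∀ {m n} (xs : Vec (Vec Bool m) n) → weight (concat xs) ≡ V.sum (V.map weight xs)
weight-concat []       = refl
weight-concat (x ∷ xs) = trans (weight-++ x (concat xs)) (cong (weight x +_) (weight-concat xs))

dist≡0⇒≡ : ∀ {N} (x y : Vec Bool N) → dist x y ≡ 0 → x ≡ y
dist≡0⇒≡ []          []          _  = refl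
dist≡0⇒≡ (true ∷ x)  (true ∷ y)  eq = cong (true ∷_) (dist≡0⇒≡ x y eq)
dist≡0⇒≡ (false ∷ x) (false ∷ y) eq = cong (false ∷_) (dist≡0⇒≡ x y eq)

commonOnes : ∀ {N} → Vec Bool N → Vec Bool N → ℕ
commonOnes []          []          = 0
commonOnes (true ∷ x)  (true ∷ y)  = suc (commonOnes x y)
commonOnes (_ ∷ x)     (_ ∷ y)     = commonOnes x y

dist+2*commonOnes≡weight+weight : ∀ {N} (x y : Vec Bool N) → dist x y + 2 * commonOnes x y ≡ weight x + weight y
dist+2*commonOnes≡weight+weight []          []          = refl
dist+2*commonOnes≡weight+weight (true ∷ x)  (true ∷ y)  = begin
  dist x y + 2 * suc (commonOnes x y)
    ≡⟨ solve 2 (λ d c → d :+ con 2 :* (con 1 :+ c) := con 2 :+ (d :+ con 2 :* c)) refl (dist x y) (commonOnes x y) ⟩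
  2 + (dist x y + 2 * commonOnes x y)       ≡⟨ cong (2 +_) (dist+2*commonOnes≡weight+weight x y) ⟩
  2 + (weight x + weight y)              ≡⟨ cong suc (+-suc (weight x) (weight y)) ⟨
  suc (weight x) + suc (weight y)        ∎
  where open ≡-Reasoning
dist+2*commonOnes≡weight+weight (true ∷ x)  (false ∷ y) = cong suc (dist+2*commonOnes≡weight+weight x y)
dist+2*commonOnes≡weight+weight (false ∷ x) (true ∷ y)  =
  trans (cong suc (dist+2*commonOnes≡weight+weight x y)) (sym (+-suc (weight x) (weight y)))
dist+2*commonOnes≡weight+weight (false ∷ x) (false ∷ y) = dist+2*commonOnes≡weight+weight x y

dist≡weight+weight : ∀ {N} (x y : Vec Bool N) → dist x y ≡ weight x + weight y mod 2
dist≡weight+weight x y = commonOnes x y , 0 , (begin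
  dist x y + commonOnes x y * 2  ≡⟨ cong (dist x y +_) (*-comm (commonOnes x y) 2) ⟩
  dist x y + 2 * commonOnes x y  ≡⟨ dist+2*commonOnes≡weight+weight x y ⟩
  weight x + weight y            ≡⟨ +-identityʳ _ ⟨
  weight x + weight y + 0 * 2    ∎)
  where open ≡-Reasoning

sum-update : ∀ {n} (v : Vec ℕ n) i → V.sum v ≡ lookup v i + V.sum (v [ i ]≔ 0)
sum-update (x ∷ v) zero    = refl
sum-update (x ∷ v) (suc i) = trans (cong (x +_) (sum-update v i))
  (solve 3 (λ x a b → x :+ (a :+ b) := a :+ (x :+ b)) refl x (lookup v i) _)

lookup≤sum : ∀ {n} (v : Vec ℕ n) i → lookup v i ≤ V.sum v
lookup≤sum v i = subst (lookup v i ≤_) (sym (sum-update v i)) (m≤m+n _ _)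

lookup+lookup≤sum : ∀ {n} (v : Vec ℕ n) {i j} → i ≢ j → lookup v i + lookup v j ≤ V.sum v
lookup+lookup≤sum v {i} {j} i≢j = begin
  lookup v i + lookup v j             ≡⟨ cong (lookup v i +_) (Vecₚ.lookup∘update′ (i≢j ∘ sym) v 0) ⟨
  lookup v i + lookup (v [ i ]≔ 0) j  ≤⟨ +-monoʳ-≤ (lookup v i) (lookup≤sum (v [ i ]≔ 0) j) ⟩
  lookup v i + V.sum (v [ i ]≔ 0)     ≡⟨ sum-update v i ⟨
  V.sum v                             ∎
  where open ≤-Reasoning

lookup+lookup+lookup≤sum : ∀ {n} (v : Vec ℕ n) {i j l} → i ≢ j → i ≢ l → j ≢ l →
  lookup v i + lookup v j + lookup v l ≤ V.sum v
lookup+lookup+lookup≤sum v {i} {j} {l} i≢j i≢l j≢l = begin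
  lookup v i + lookup v j + lookup v l  ≡⟨ +-assoc (lookup v i) _ _ ⟩
  lookup v i + (lookup v j + lookup v l)
    ≡⟨ cong₂ (λ a b → lookup v i + (a + b)) (lookup-v′ (i≢j ∘ sym)) (lookup-v′ (i≢l ∘ sym)) ⟨
  lookup v i + (lookup v′ j + lookup v′ l)  ≤⟨ +-monoʳ-≤ (lookup v i) (lookup+lookup≤sum v′ j≢l) ⟩
  lookup v i + V.sum v′                     ≡⟨ sum-update v i ⟨
  V.sum v                                   ∎
  where
    open ≤-Reasoning
    v′ = v [ i ]≔ 0
    lookup-v′ : ∀ {m} → m ≢ i → lookup v′ m ≡ lookup v m
    lookup-v′ m≢i = Vecₚ.lookup∘update′ m≢i v 0

module _ (k : ℕ) where

  private
    q = 2 ^ k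
    instance
      q≢0 : NonZero q
      q≢0 = m^n≢0 2 k

    ≤-*-cancelʳ-mod-odd : ∀ {a b δ} → b ≤ a → a * δ ≡ b * δ mod q → ¬ 2 ∣ δ → a ≡ b mod q
    ≤-*-cancelʳ-mod-odd {a} {b} {δ} b≤a aδ≡bδ δ-odd = begin
      a            ≡⟨ m+[n∸m]≡n b≤a ⟨
      b + (a ∸ b)  ≈⟨ mod-+ (mod-refl {a = b}) (∣⇒mod0 q q∣a∸b) ⟩
      b + 0        ≡⟨ +-identityʳ b ⟩
      b            ∎
      where
        open ≡-mod-Reasoning q
        [a∸b]δ≡0 : (a ∸ b) * δ ≡ 0 mod q
        [a∸b]δ≡0 = mod-cancel-+ˡ (b * δ) (begin
          b * δ + (a ∸ b) * δ  ≡⟨ *-distribʳ-+ δ b (a ∸ b) ⟨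
          (b + (a ∸ b)) * δ    ≡⟨ cong (_* δ) (m+[n∸m]≡n b≤a) ⟩
          a * δ                ≈⟨ aδ≡bδ ⟩
          b * δ                ≡⟨ +-identityʳ _ ⟨
          b * δ + 0            ∎)
        q∣a∸b : q ∣ a ∸ b
        q∣a∸b = p^k∣m*n∧p∤n⇒p^k∣m prime[2] k (a ∸ b) δ (mod0⇒∣ q [a∸b]δ≡0) δ-odd

  *-cancelʳ-mod-odd : ∀ {a b δ} → a * δ ≡ b * δ mod q → ¬ 2 ∣ δ → a ≡ b mod q
  *-cancelʳ-mod-odd {a} {b} aδ≡bδ δ-odd with ≤-total b a
  ... | inj₁ b≤a = ≤-*-cancelʳ-mod-odd b≤a aδ≡bδ δ-odd
  ... | inj₂ a≤b = mod-sym (≤-*-cancelʳ-mod-odd a≤b (mod-sym aδ≡bδ) δ-odd)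

  private
    ≤-cross-cancel : ∀ {a b X X′} → X′ ≤ X → a * X + b * X′ ≡ a * X′ + b * X mod q → ¬ X ≡ X′ mod 2 → a ≡ b mod q
    ≤-cross-cancel {a} {b} {X} {X′} X′≤X eq X≢X′ = *-cancelʳ-mod-odd (mod-cancel-+ˡ (a * X′ + b * X′) (begin
      a * X′ + b * X′ + a * δ
        ≡⟨ solve 4 (λ a b X′ δ → a :* X′ :+ b :* X′ :+ a :* δ := a :* (X′ :+ δ) :+ b :* X′) refl a b X′ δ ⟩
      a * (X′ + δ) + b * X′      ≡⟨ cong (λ z → a * z + b * X′) X′+δ≡X ⟩
      a * X + b * X′             ≈⟨ eq ⟩
      a * X′ + b * X             ≡⟨ cong (λ z → a * X′ + b * z) X′+δ≡X ⟨
      a * X′ + b * (X′ + δ)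
        ≡⟨ solve 4 (λ a b X′ δ → a :* X′ :+ b :* (X′ :+ δ) := a :* X′ :+ b :* X′ :+ b :* δ) refl a b X′ δ ⟩
      a * X′ + b * X′ + b * δ    ∎)) δ-odd
      where
        open ≡-mod-Reasoning q
        δ = X ∸ X′
        X′+δ≡X : X′ + δ ≡ X
        X′+δ≡X = m+[n∸m]≡n X′≤X
        δ-odd : ¬ 2 ∣ δ
        δ-odd 2∣δ = X≢X′ (subst (_≡ X′ mod 2) X′+δ≡X
          (mod-trans (mod-+ (mod-refl {a = X′}) (∣⇒mod0 2 2∣δ)) (≡⇒mod (+-identityʳ X′))))

  -- In ℤ: (a − b)(X − X′) ≡ 0 (mod 2^k) with X − X′ odd forces a ≡ b.
  cross-cancel : ∀ {a b X X′} → a * X + b * X′ ≡ a * X′ + b * X mod q → ¬ X ≡ X′ mod 2 → a ≡ b mod q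
  cross-cancel {X = X} {X′} eq X≢X′ with ≤-total X′ X
  ... | inj₁ X′≤X = ≤-cross-cancel X′≤X eq X≢X′
  ... | inj₂ X≤X′ = ≤-cross-cancel X≤X′ (mod-sym eq) (X≢X′ ∘ mod-sym)

module DyadicCode (k : ℕ) (rest : List (List ℕ)) (subgroups : All (IsSubgroup (2 ^ suc k)) rest) where

  q = 2 ^ suc k

  instance
    q≢0 : NonZero q
    q≢0 = m^n≢0 2 (suc k)

  1<q : 1 < q
  1<q = *-monoʳ-≤ 2 (m^n>0 2 k)

  open ZqVectors q
  open LinearCode q 1<q rest subgroups

  agree-except-two⇒same-parity : ∀ {x x′} → Orthogonal x → Orthogonal x′ → ∀ {i j} → i ≢ j →
    (∀ l → l ≢ i → l ≢ j → lookup x l ≡ lookup x′ l) → x ! i ≡ x′ ! i mod 2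
  agree-except-two⇒same-parity {x} {x′} x⊥ x′⊥ {i} {j} i≢j agree with x ! i % 2 ≟ x′ ! i % 2
  ... | yes xᵢ≡x′ᵢ = %≡⇒mod 2 xᵢ≡x′ᵢ
  ... | no  xᵢ≢x′ᵢ = contradiction (rows-agree⇒≡ i j λ t →
          mod-<⇒≡ q (cross-cancel (suc k) (column-relation t) (xᵢ≢x′ᵢ ∘ mod⇒%≡ 2)) (row-< t i) (row-< t j)) i≢j
    where
      relation = agree-except-two⇒row-relation x⊥ x′⊥ i≢j agree

      sums : x ! i + x ! j ≡ x′ ! i + x′ ! j mod q
      sums = subst₂ (λ u v → u ≡ v mod q) (cong₂ _+_ (*-identityˡ (x ! i)) (*-identityˡ (x ! j)))
                                          (cong₂ _+_ (*-identityˡ (x′ ! i)) (*-identityˡ (x′ ! j)))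
        (subst₂ (λ a b → a * x ! i + b * x ! j ≡ a * x′ ! i + b * x′ ! j mod q) (row-zero i) (row-zero j)
          (relation zero))

      -- Row t minus b times row 0; in ℤ this reads (a − b)(x_i − x′_i) ≡ 0.
      column-relation : ∀ t → let a = lookup (row t) i ; b = lookup (row t) j in
        a * x ! i + b * x′ ! i ≡ a * x′ ! i + b * x ! i mod q
      column-relation t = mod-cancel-+ˡ (b * Y + b * Y′) (begin
        b * Y + b * Y′ + (a * X + b * X′)    ≡⟨ solve 6 (λ a b X X′ Y Y′ →
                                                   b :* Y :+ b :* Y′ :+ (a :* X :+ b :* X′)
                                                     := a :* X :+ b :* Y :+ b :* (X′ :+ Y′))
                                                 refl a b X X′ Y Y′ ⟩
        a * X + b * Y + b * (X′ + Y′)        ≈⟨ mod-+ (relation t) (mod-*ˡ b (mod-sym sums)) ⟩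
        a * X′ + b * Y′ + b * (X + Y)        ≡⟨ solve 6 (λ a b X X′ Y Y′ →
                                                   a :* X′ :+ b :* Y′ :+ b :* (X :+ Y)
                                                     := b :* Y :+ b :* Y′ :+ (a :* X′ :+ b :* X))
                                                 refl a b X X′ Y Y′ ⟩
        b * Y + b * Y′ + (a * X′ + b * X)    ∎)
        where
          open ≡-mod-Reasoning q
          a = lookup (row t) i
          b = lookup (row t) j
          X = x ! i
          X′ = x′ ! i
          Y = x ! j
          Y′ = x′ ! j

  module Distance (H : ℕ → Vec Bool (2 ^ k) → Set)
    (H-distance : ∀ j → j < q → ∀ x y → H j x → H j y → x ≢ y → 4 ≤ dist x y)
    (H-disjoint : ∀ j j′ w → j < q → j′ < q → H j w → H j′ w → j ≡ j′)
    (H-parity : ∀ j w → j < q → H j w → weight w % 2 ≡ j % 2) where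

    Blocks : ∀ {n} → Vec (Fin q) n → Vec (Vec Bool (2 ^ k)) n → Set
    Blocks x ys = ∀ i → H (x ! i) (lookup ys i)

    weight≡class-mod-2 : ∀ {a : Fin q} {w} → H (toℕ a) w → weight w ≡ toℕ a mod 2
    weight≡class-mod-2 {a} w∈H = %≡⇒mod 2 (H-parity _ _ (toℕ<n a) w∈H)

    weight-concat≡sum : ∀ {n} (x : Vec (Fin q) n) ys → Blocks x ys → weight (concat ys) ≡ V.sum (V.map toℕ x) mod 2
    weight-concat≡sum x ys blocks = mod-trans (≡⇒mod (weight-concat ys)) (sum≡ x ys blocks)
      where
        sum≡ : ∀ {n} (x : Vec (Fin q) n) ys → Blocks x ys → V.sum (V.map weight ys) ≡ V.sum (V.map toℕ x) mod 2
        sum≡ V.[] V.[] _ = mod-refl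
        sum≡ (a V.∷ x) (w V.∷ ys) blocks = mod-+ (weight≡class-mod-2 (blocks zero)) (sum≡ x ys (blocks ∘ suc))

    orthogonal⇒weight-even : ∀ {x} ys → Orthogonal x → Blocks x ys → weight (concat ys) ≡ 0 mod 2
    orthogonal⇒weight-even {x} ys x⊥ blocks = mod-trans (weight-concat≡sum x ys blocks)
      (mod-∣ (m∣m*n (2 ^ k)) (subst (_≡ 0 mod q) (dot-row-zero x) (x⊥ zero)))

    ≢-class⇒1≤dist : ∀ {a a′ : Fin q} {w w′} → a ≢ a′ → H (toℕ a) w → H (toℕ a′) w′ → 1 ≤ dist w w′
    ≢-class⇒1≤dist {a} {a′} {w} {w′} a≢a′ w∈H w′∈H with dist w w′ in eq
    ... | suc _ = s≤s z≤n
    ... | zero  = contradiction (toℕ-injective (H-disjoint _ _ w (toℕ<n a) (toℕ<n a′) w∈H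
                    (subst (H (toℕ a′)) (sym (dist≡0⇒≡ w w′ eq)) w′∈H))) a≢a′

    ≢-class∧same-parity⇒2≤dist : ∀ {a a′ : Fin q} {w w′} → a ≢ a′ → toℕ a ≡ toℕ a′ mod 2 →
      H (toℕ a) w → H (toℕ a′) w′ → 2 ≤ dist w w′
    ≢-class∧same-parity⇒2≤dist {a} {a′} {w} {w′} a≢a′ a≡a′ w∈H w′∈H
      with dist w w′ in eq | ≢-class⇒1≤dist a≢a′ w∈H w′∈H
    ... | suc (suc _) | _ = s≤s (s≤s z≤n)
    ... | suc zero    | _ = contradiction (mod⇒%≡ 2 1≡0) λ ()
      where
        open ≡-mod-Reasoning 2
        1≡0 : 1 ≡ 0 mod 2
        1≡0 = begin
          1                       ≡⟨ eq ⟨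
          dist w w′               ≈⟨ dist≡weight+weight w w′ ⟩
          weight w + weight w′    ≈⟨ mod-+ (weight≡class-mod-2 w∈H) (weight≡class-mod-2 w′∈H) ⟩
          toℕ a + toℕ a′          ≈⟨ mod-+ a≡a′ mod-refl ⟩
          toℕ a′ + toℕ a′         ≡⟨ cong (toℕ a′ +_) (+-identityʳ (toℕ a′)) ⟨
          2 * toℕ a′              ≡⟨ *-comm 2 (toℕ a′) ⟩
          toℕ a′ * 2              ≈⟨ *-mod-self (toℕ a′) ⟩
          0                       ∎

    differs? : ∀ {n} (x x′ : Vec (Fin q) n) i → Dec (lookup x i ≢ lookup x′ i)
    differs? x x′ i = ¬? (lookup x i F.≟ lookup x′ i)

    differences : ∀ {n} → Vec (Fin q) n → Vec (Fin q) n → List (Fin n)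
    differences x x′ = filter (differs? x x′) (L.allFin _)

    ∈-differences⁺ : ∀ {n} (x x′ : Vec (Fin q) n) {i} → lookup x i ≢ lookup x′ i → i ∈ differences x x′
    ∈-differences⁺ x x′ {i} = ∈-filter⁺ (differs? x x′) (∈-allFin i)

    ∈-differences⁻ : ∀ {n} (x x′ : Vec (Fin q) n) {i} → i ∈ differences x x′ → lookup x i ≢ lookup x′ i
    ∈-differences⁻ {n} x x′ = proj₂ ∘ ∈-filter⁻ (differs? x x′) {xs = L.allFin n}

    ∉-differences : ∀ {n} (x x′ : Vec (Fin q) n) {i} → i ∉ differences x x′ → lookup x i ≡ lookup x′ i
    ∉-differences x x′ {i} i∉ with lookup x i F.≟ lookup x′ i
    ... | yes xᵢ≡x′ᵢ = xᵢ≡x′ᵢ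
    ... | no  xᵢ≢x′ᵢ = contradiction (∈-differences⁺ x x′ xᵢ≢x′ᵢ) i∉

    Unique-differences : ∀ {n} (x x′ : Vec (Fin q) n) → Unique (differences x x′)
    Unique-differences {n} x x′ = Unique.filter⁺ (differs? x x′) (Unique.allFin⁺ n)

    even∧3≤⇒4≤ : ∀ {D} → 3 ≤ D → D ≡ 0 mod 2 → 4 ≤ D
    even∧3≤⇒4≤ {0} ()
    even∧3≤⇒4≤ {1} (s≤s ())
    even∧3≤⇒4≤ {2} (s≤s (s≤s ()))
    even∧3≤⇒4≤ {3} _ D≡0 with mod⇒%≡ 2 D≡0
    ... | ()
    even∧3≤⇒4≤ {suc (suc (suc (suc _)))} _ _ = s≤s (s≤s (s≤s (s≤s z≤n)))

    codeword-distance : ∀ {x x′ : Vec (Fin q) n} {ys ys′} → Orthogonal x → Orthogonal x′ →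
      Blocks x ys → Blocks x′ ys′ → concat ys ≢ concat ys′ → 4 ≤ dist (concat ys) (concat ys′)
    codeword-distance {x} {x′} {ys} {ys′} x⊥ x′⊥ blocks blocks′ ys≢ys′ = subst (4 ≤_) (sym (dist-concat ys ys′))
      (by-differences (differences x x′) (Unique-differences x x′) (∈-differences⁻ x x′) (∉-differences x x′))
      where
        v = V.zipWith dist ys ys′

        vᵢ≡ : ∀ i → lookup v i ≡ dist (lookup ys i) (lookup ys′ i)
        vᵢ≡ i = Vecₚ.lookup-zipWith dist i ys ys′

        even : V.sum v ≡ 0 mod 2
        even = begin
          V.sum v                                   ≡⟨ dist-concat ys ys′ ⟨
          dist (concat ys) (concat ys′)             ≈⟨ dist≡weight+weight (concat ys) (concat ys′) ⟩
          weight (concat ys) + weight (concat ys′)  ≈⟨ mod-+ (orthogonal⇒weight-even ys x⊥ blocks)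
                                                             (orthogonal⇒weight-even ys′ x′⊥ blocks′) ⟩
          0                                         ∎
          where open ≡-mod-Reasoning 2

        differs⇒1≤ : ∀ {i} → lookup x i ≢ lookup x′ i → 1 ≤ lookup v i
        differs⇒1≤ {i} xᵢ≢x′ᵢ = subst (1 ≤_) (sym (vᵢ≡ i)) (≢-class⇒1≤dist xᵢ≢x′ᵢ (blocks i) (blocks′ i))

        same-class⇒4≤ : ∀ i → lookup x i ≡ lookup x′ i → lookup ys i ≢ lookup ys′ i → 4 ≤ lookup v i
        same-class⇒4≤ i xᵢ≡x′ᵢ ysᵢ≢ys′ᵢ = subst (4 ≤_) (sym (vᵢ≡ i)) (H-distance _ (toℕ<n _) _ _ (blocks i)
          (subst (λ a → H (toℕ a) (lookup ys′ i)) (sym xᵢ≡x′ᵢ) (blocks′ i)) ysᵢ≢ys′ᵢ)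

        by-differences : (D : List (Fin n)) → Unique D → (∀ {i} → i ∈ D → lookup x i ≢ lookup x′ i) →
          (∀ {i} → i ∉ D → lookup x i ≡ lookup x′ i) → 4 ≤ V.sum v
        by-differences [] _ _ agree = ≤-trans (same-class⇒4≤ i (agree λ ()) ysᵢ≢ys′ᵢ) (lookup≤sum v i)
          where
            differing-block = ¬∀⟶∃¬ n (λ i → lookup ys i ≡ lookup ys′ i)
              (λ i → Vecₚ.≡-dec _≟ᵇ_ (lookup ys i) (lookup ys′ i))
              (λ ys≗ys′ → ys≢ys′ (cong concat (lookup-extensionality ys ys′ ys≗ys′)))
            i = proj₁ differing-block
            ysᵢ≢ys′ᵢ = proj₂ differing-block
        by-differences (i ∷ []) _ differ agree = contradiction
          (agree-except-one⇒agree x⊥ x′⊥ i λ l l≢i → agree λ { (here l≡i) → l≢i l≡i })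
          (differ (here refl))
        by-differences (i ∷ j ∷ []) ((i≢j ∷ []) ∷ _) differ agree = even∧3≤⇒4≤ (begin
          3                        ≤⟨ +-mono-≤ 2≤vᵢ (differs⇒1≤ (differ (there (here refl)))) ⟩
          lookup v i + lookup v j  ≤⟨ lookup+lookup≤sum v i≢j ⟩
          V.sum v                  ∎) even
          where
            open ≤-Reasoning
            xᵢ≡x′ᵢ = agree-except-two⇒same-parity x⊥ x′⊥ i≢j λ l l≢i l≢j →
              agree λ { (here l≡i) → l≢i l≡i ; (there (here l≡j)) → l≢j l≡j }
            2≤vᵢ = subst (2 ≤_) (sym (vᵢ≡ i))
              (≢-class∧same-parity⇒2≤dist (differ (here refl)) xᵢ≡x′ᵢ (blocks i) (blocks′ i))
        by-differences (i ∷ j ∷ l ∷ _) ((i≢j ∷ i≢l ∷ _) ∷ (j≢l ∷ _) ∷ _) differ _ = even∧3≤⇒4≤ (begin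
          3                                     ≤⟨ +-mono-≤ (+-mono-≤ (differs⇒1≤ (differ (here refl)))
                                                                      (differs⇒1≤ (differ (there (here refl)))))
                                                            (differs⇒1≤ (differ (there (there (here refl))))) ⟩
          lookup v i + lookup v j + lookup v l  ≤⟨ lookup+lookup+lookup≤sum v i≢j i≢l j≢l ⟩
          V.sum v                               ∎) even
          where open ≤-Reasoning

    Φ-distance : ∀ y y′ → Φ H IsCodeword y → Φ H IsCodeword y′ → y ≢ y′ → 4 ≤ dist y y′
    Φ-distance _ _ (x , x∈C , ys , refl , blocks) (x′ , x′∈C , ys′ , refl , blocks′) =
      codeword-distance {ys = ys} {ys′} (codeword⇒orthogonal x∈C) (codeword⇒orthogonal x′∈C) blocks blocks′

^-distribʳ-* : ∀ a b n → (a * b) ^ n ≡ a ^ n * b ^ n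
^-distribʳ-* a b zero    = refl
^-distribʳ-* a b (suc n) = trans (cong (a * b *_) (^-distribʳ-* a b n))
  (solve 4 (λ a b x y → a :* b :* (x :* y) := a :* x :* (b :* y)) refl a b (a ^ n) (b ^ n))

1+n≤2^n : ∀ n → suc n ≤ 2 ^ n
1+n≤2^n zero    = s≤s z≤n
1+n≤2^n (suc n) = subst (suc (suc n) ≤_) (cong (2 ^ n +_) (sym (+-identityʳ (2 ^ n))))
  (+-mono-≤ (m^n>0 2 n) (1+n≤2^n n))

2^m∣2^n : ∀ {m n} → m ≤ n → 2 ^ m ∣ 2 ^ n
2^m∣2^n {m} {n} m≤n = subst (2 ^ m ∣_) (trans (sym (^-distribˡ-+-* 2 m (n ∸ m))) (cong (2 ^_) (m+[n∸m]≡n m≤n)))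
  (m∣m*n (2 ^ (n ∸ m)))

div≡/ : ∀ a d .{{_ : NonZero d}} → a div d ≡ a / d
div≡/ a (suc d) = refl

div-exact : ∀ {a d X} .{{_ : NonZero d}} → a ≡ d * X → a div d ≡ X
div-exact {d = suc d} {X} a≡dX = trans (cong (_/ suc d) (trans a≡dX (*-comm (suc d) X))) (m*n/n≡m X (suc d))

subgroupElems-isSubgroup : ∀ k j → j ≤ k → IsSubgroup (2 ^ k) (subgroupElems k j)
subgroupElems-isSubgroup k j j≤k = record
  { d = 2 ^ (k ∸ j) ; e = 2 ^ j ; d≢0 = m^n≢0 2 (k ∸ j) ; e≢0 = m^n≢0 2 j
  ; d*e≡q = trans (sym (^-distribˡ-+-* 2 (k ∸ j) j)) (cong (2 ^_) (m∸n+n≡m j≤k)) ; S≡dℤ = refl }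

product-map-concat : ∀ {A : Set} (f : A → ℕ) (xss : List (List A)) →
  product (L.map f (L.concat xss)) ≡ product (L.map (λ xs → product (L.map f xs)) xss)
product-map-concat f []         = refl
product-map-concat f (xs ∷ xss) = begin
  product (L.map f (xs L.++ L.concat xss))                     ≡⟨ cong product (map-++ f xs (L.concat xss)) ⟩
  product (L.map f xs L.++ L.map f (L.concat xss))             ≡⟨ product-++ (L.map f xs) _ ⟩
  product (L.map f xs) * product (L.map f (L.concat xss))
    ≡⟨ cong (product (L.map f xs) *_) (product-map-concat f xss) ⟩
  product (L.map f xs) * product (L.map (λ xs → product (L.map f xs)) xss) ∎
  where open ≡-Reasoning

product-length-replicate : ∀ {A : Set} c (xs : List A) → product (L.map length (replicate c xs)) ≡ length xs ^ c
product-length-replicate zero    xs = refl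
product-length-replicate (suc c) xs = cong (length xs *_) (product-length-replicate c xs)

product-pow : ∀ a {k} (es : Vec ℕ k) → product (toList (V.map (a ^_) es)) ≡ a ^ sum (toList es)
product-pow a []       = refl
product-pow a (e ∷ es) = trans (cong (a ^ e *_) (product-pow a es)) (sym (^-distribˡ-+-* a e _))

module _ (k : ℕ) (I : Vec ℕ k) where

  private
    copies : Fin k → List (List ℕ)
    copies j = replicate (lookup I j) (subgroupElems k (suc (toℕ j)))

    blocks : Vec (List (List ℕ)) k
    blocks = V.map copies (allFin k)

  subgroupSets : List (List ℕ)
  subgroupSets = L.concat (toList blocks)

  subgroupSets-isSubgroup : All (IsSubgroup (2 ^ k)) subgroupSets
  subgroupSets-isSubgroup = Allₚ.concat⁺
    (subst (All (All (IsSubgroup (2 ^ k)))) (sym (Vecₚ.toList-map copies (allFin k))) (Allₚ.map⁺ (All.tabulate λ {j} _ →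
      Allₚ.replicate⁺ (lookup I j) (subgroupElems-isSubgroup k (suc (toℕ j)) (toℕ<n j)))))

  length-columns : length (columns k I) ≡ 2 ^ weightedSum I
  length-columns = begin
    length (columns k I)                             ≡⟨ length-tuples (choiceSets k I) ⟩
    1 * product (map length subgroupSets)            ≡⟨ *-identityˡ _ ⟩
    product (map length (L.concat (toList blocks)))  ≡⟨ product-map-concat length (toList blocks) ⟩
    product (map blockSize (toList blocks))          ≡⟨ cong product (Vecₚ.toList-map blockSize blocks) ⟨
    product (toList (V.map blockSize blocks))        ≡⟨ cong (product ∘ toList) blockSizes≡ ⟩
    product (toList (V.map (2 ^_) exponents))        ≡⟨ product-pow 2 exponents ⟩
    2 ^ weightedSum I                                ∎
    where
      open ≡-Reasoning
      blockSize : List (List ℕ) → ℕ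
      blockSize xss = product (map length xss)
      exponents : Vec ℕ k
      exponents = V.zipWith _*_ (V.map (λ j → suc (toℕ j)) (allFin k)) I
      blockSize≡ : ∀ j → lookup (V.map blockSize blocks) j ≡ lookup (V.map (2 ^_) exponents) j
      blockSize≡ j = begin
        lookup (V.map blockSize blocks) j                ≡⟨ Vecₚ.lookup-map j blockSize blocks ⟩
        blockSize (lookup blocks j)                      ≡⟨ cong blockSize (lookup-map-allFin copies j) ⟩
        blockSize (copies j)                             ≡⟨ product-length-replicate (lookup I j) _ ⟩
        length (subgroupElems k (suc (toℕ j))) ^ lookup I j
          ≡⟨ cong (_^ lookup I j) (trans (length-map _ (upTo (2 ^ suc (toℕ j)))) (length-upTo _)) ⟩
        (2 ^ suc (toℕ j)) ^ lookup I j                   ≡⟨ ^-*-assoc 2 (suc (toℕ j)) (lookup I j) ⟩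
        2 ^ (suc (toℕ j) * lookup I j)
          ≡⟨ cong (λ e → 2 ^ (e * lookup I j)) (lookup-map-allFin (λ j → suc (toℕ j)) j) ⟨
        2 ^ (lookup (V.map (λ j → suc (toℕ j)) (allFin k)) j * lookup I j)
          ≡⟨ cong (2 ^_) (Vecₚ.lookup-zipWith _*_ j (V.map (λ j → suc (toℕ j)) (allFin k)) I) ⟨
        2 ^ lookup exponents j                           ≡⟨ Vecₚ.lookup-map j (2 ^_) exponents ⟨
        lookup (V.map (2 ^_) exponents) j                ∎
      blockSizes≡ : V.map blockSize blocks ≡ V.map (2 ^_) exponents
      blockSizes≡ = lookup-extensionality _ _ blockSize≡

perfectSize*2^suc≡2^2^ : ∀ k → perfectSize (2 ^ k) * 2 ^ suc k ≡ 2 ^ 2 ^ k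
perfectSize*2^suc≡2^2^ k = trans (cong (_* 2 ^ suc k) (div≡/ (2 ^ 2 ^ k) (2 ^ suc k) {{m^n≢0 2 (suc k)}}))
  (m/n*n≡m {{m^n≢0 2 (suc k)}} (2^m∣2^n (1+n≤2^n k)))

perfectSize-product : ∀ n m K .{{_ : NonZero n}} .{{_ : NonZero m}} → perfectSize m * (2 * m) ≡ 2 ^ m →
  (2 * m) ^ n ≡ 2 * m * n * K → perfectSize (n * m) ≡ K * perfectSize m ^ n
perfectSize-product n m K s*2m≡2^m count = div-exact {{m*n≢0 2 (n * m) {{_}} {{m*n≢0 n m}}}} (begin
  2 ^ (n * m)                   ≡⟨ cong (2 ^_) (*-comm n m) ⟩
  2 ^ (m * n)                   ≡⟨ ^-*-assoc 2 m n ⟨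
  (2 ^ m) ^ n                   ≡⟨ cong (_^ n) s*2m≡2^m ⟨
  (s * (2 * m)) ^ n             ≡⟨ ^-distribʳ-* s (2 * m) n ⟩
  s ^ n * (2 * m) ^ n           ≡⟨ cong (s ^ n *_) count ⟩
  s ^ n * (2 * m * n * K)
    ≡⟨ solve 4 (λ x m n K → x :* (con 2 :* m :* n :* K) := con 2 :* (n :* m) :* (K :* x)) refl (s ^ n) m n K ⟩
  2 * (n * m) * (K * s ^ n)     ∎)
  where
    open ≡-Reasoning
    s = perfectSize m

theorem2 : (k : ℕ) → 1 ≤ k → (r : ℕ) → (I : Vec ℕ k) → weightedSum I ≡ r →
    (H : ℕ → Vec Bool (mOf k) → Set) → IsGoodPartition (mOf k) H →
    length (columns k I) ≡ 2 ^ r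
    × IsBinaryCode (length (columns k I) * mOf k) (perfectSize (2 ^ r * mOf k)) 4
        (Φ H (HI k I))
theorem2 (suc k) _ r I refl H (H-codes , _ , H-disjoint , _ , H-parity) =
  length-columns (suc k) I , subst (HasSize (Φ H (HI (suc k) I))) |Φ|≡ Φ-size-kernel , Φ-distance
  where
    open DyadicCode k (subgroupSets (suc k) I) (subgroupSets-isSubgroup (suc k) I)
    open LinearCode q 1<q (subgroupSets (suc k) I) (subgroupSets-isSubgroup (suc k) I)
    open Distance H (λ j j<q → proj₂ (H-codes j j<q)) H-disjoint H-parity
    s = perfectSize (2 ^ k)
    instance
      n≢0 : NonZero n
      n≢0 = subst NonZero (sym (length-columns (suc k) I)) (m^n≢0 2 r)
    Φ-size-kernel : HasSize (Φ H IsCodeword) (length kernel * s ^ n)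
    Φ-size-kernel =
      Φ-size H (λ j j<q → proj₁ (H-codes j j<q)) H-disjoint IsCodeword kernel Unique-kernel ∈kernel⇔codeword
    |Φ|≡ : length kernel * s ^ n ≡ perfectSize (2 ^ r * 2 ^ k)
    |Φ|≡ = begin
      length kernel * s ^ n       ≡⟨ perfectSize-product n (2 ^ k) (length kernel) {{n≢0}} {{m^n≢0 2 k}}
                                       (perfectSize*2^suc≡2^2^ k) q^n≡qn*|kernel| ⟨
      perfectSize (n * 2 ^ k)     ≡⟨ cong (λ n → perfectSize (n * 2 ^ k)) (length-columns (suc k) I) ⟩
      perfectSize (2 ^ r * 2 ^ k) ∎
      where open ≡-Reasoning
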